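{- Let $A$ be a totally ordered alphabet and let $w$ be a Lyndon word over $A$. Then the left Lyndon tree $\mathrm{lst}(w)$ and the left Cartesian tree $\mathrm{tl}(w)$ are equal (as complete planar binary trees with leaves labeled by letters, disregarding labels of internal nodes).
   Context: The order $<$ on finite and infinite words is the lexicographical order induced by the order of $A$; for a nonempty finite word $x$, $x^\omega=xxx\cdots$. A nonempty word $w$ is a Lyndon word if for every factorization $w=uv$ with $u,v$ nonempty one has $w<v$. The left standard factorization of a Lyndon word $w$ with $|w|\ge2$ is $w=uv$ with $u$ the longest nonempty proper prefix of $w$ that is a Lyndon word (then $u,v$ are Lyndon). Complete trees: each letter is a tree, and $(\mathfrak t_1,\mathfrak t_2)$ is a tree for trees $\mathfrak t_1,\mathfrak t_2$; foliage $\varphi(a)=a$, $\varphi((\mathfrak t_1,\mathfrak t_2))=\varphi(\mathfrak t_1)\varphi(\mathfrak t_2)$. Left Lyndon tree: $\mathrm{lst}(a)=a$ for a letter, $\mathrm{lst}(w)=(\mathrm{lst}(u),\mathrm{lst}(v))$ for the left standard factorization $w=uv$. Order $\prec$ on nonempty words: $u\prec v$ if $u^\omega<v^\omega$, or $u^\omega=v^\omega$ and $|u|>|v|$. For $w$ of length $n+1$ with nonempty prefixes $p_1,\dots,p_{n+1}=w$ (by increasing length), the prefix standard permutation is the unique $\sigma\in\mathfrak S_{n+1}$ with $p_{\sigma^{ -1}(1)}\prec p_{\sigma^{ -1}(2)}\prec\cdots\prec p_{\sigma^{ -1}(n+1)}$; for a Lyndon word, $\sigma(n+1)=n+1$. Decreasing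 tree of an injective word $\alpha$ over a totally ordered alphabet: the root is the maximal letter $m$ of $\alpha$, and writing $\alpha=u\,m\,v$, its left and right subtrees (possibly empty) are the decreasing trees of $u$ and $v$. Left Cartesian tree: $\mathrm{tl}(a)=a$ for a letter $a$; if $|w|=n+1\ge2$, let $\alpha=\sigma(1)\sigma(2)\cdots\sigma(n)\in\mathfrak S_n$ (the word of $\sigma$ with its last entry $n+1$ removed), let $\mathfrak t^*$ be the decreasing tree of $\alpha$ (a binary tree with $n$ nodes), and let $\mathrm{tl}(w)$ be the complete binary tree whose internal nodes form $\mathfrak t^*$, with leaves (added at every missing child position, $n+1$ of them) labeled by the letters of $w$ from left to right, so that $\varphi(\mathrm{tl}(w))=w$. -}

module Defs where

open import Level using (0ℓ)
open import Data.Nat using (ℕ; zero; suc; _≤_; _%_)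
import Data.Nat as ℕ
open import Data.Fin using (Fin; toℕ; inject₁)
import Data.Fin as Fin
open import Data.Fin.Permutation using (Permutation′; _⟨$⟩ʳ_; _⟨$⟩ˡ_)
open import Data.List using (List; []; _∷_; _++_; length; take; map; allFin)
open import Data.List.Relation.Unary.All using (All)
open import Data.List.Relation.Binary.Lex.Strict using (Lex-<)
open import Data.Maybe using (Maybe; just; nothing)
open import Data.Product using (Σ; ∃; _×_; _,_; proj₂)
open import Data.Sum using (_⊎_)
open import Relation.Binary.Core using (Rel)
open import Relation.Binary.PropositionalEquality using (_≡_; _≢_)

data Tree (A : Set) : Set where
  leaf : A → Tree A
  node : Tree A → Tree A → Tree A

data BTree : Set where
  empty : BTree
  bnode : BTree → ℕ → BTree → BTree

-- Decreasing tree of a word α over ℕ: root is the maximal letter m,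
-- α = u m v, left/right subtrees are decreasing trees of u and v.
-- (For injective α this relation is functional.)
data IsDecTree : List ℕ → BTree → Set where
  dempty : IsDecTree [] empty
  dnode  : ∀ {u v m l r} →
           All (ℕ._< m) u → All (ℕ._< m) v →
           IsDecTree u l → IsDecTree v r →
           IsDecTree (u ++ m ∷ v) (bnode l m r)

-- Complete a binary tree by adding leaves at every missing child
-- position, labeled from left to right by the given letters.
-- Returns the complete tree and the unused letters.
fill : {A : Set} → BTree → List A → Maybe (Tree A × List A)
fill empty []       = nothing
fill empty (a ∷ as) = just (leaf a , as)
fill (bnode l _ r) as with fill l as
... | nothing = nothing
... | just (t₁ , as′) with fill r as′
...   | nothing = nothing
...   | just (t₂ , as″) = just (node t₁ t₂ , as″)

module Words {A : Set} (_<_ : Rel A 0ℓ) where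

  -- lexicographic order on finite words (proper prefix is smaller)
  _<ʷ_ : List A → List A → Set
  _<ʷ_ = Lex-< _≡_ _<_

  Lyndon : List A → Set
  Lyndon w = (w ≢ []) ×
    (∀ u v → u ≢ [] → v ≢ [] → w ≡ u ++ v → w <ʷ v)

  LeftStdFact : List A → List A → List A → Set
  LeftStdFact w u v = (w ≡ u ++ v) × (u ≢ []) × (v ≢ []) × Lyndon u ×
    (∀ u′ v′ → w ≡ u′ ++ v′ → u′ ≢ [] → v′ ≢ [] → Lyndon u′ →
       length u′ ≤ length u)

  data IsLst : List A → Tree A → Set where
    lst-letter : ∀ a → IsLst (a ∷ []) (leaf a)
    lst-node   : ∀ {w u v t₁ t₂} → LeftStdFact w u v →
                 IsLst u t₁ → IsLst v t₂ → IsLst w (node t₁ t₂)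

  InfWord : Set
  InfWord = ℕ → A

  nth : A → List A → ℕ → A
  nth d []       _       = d
  nth d (x ∷ xs) zero    = x
  nth d (x ∷ xs) (suc i) = nth d xs i

  _^ω : Σ A (λ _ → List A) → InfWord
  ((a , xs) ^ω) i = nth a (a ∷ xs) (i % suc (length xs))

  _<∞_ : InfWord → InfWord → Set
  x <∞ y = ∃ λ n → (∀ i → i ℕ.< n → x i ≡ y i) × (x n < y n)

  -- the order ≺ on nonempty words (a nonempty word a ∷ xs is given as (a , xs))
  _≺_ : Σ A (λ _ → List A) → Σ A (λ _ → List A) → Set
  u ≺ v = ((u ^ω) <∞ (v ^ω)) ⊎
          ((∀ i → (u ^ω) i ≡ (v ^ω) i) ×
           (length (proj₂ v) ℕ.< length (proj₂ u)))

  prefix : (a : A) (xs : List A) → Fin (suc (length xs)) → Σ A (λ _ → List A)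
  prefix a xs k = a , take (toℕ k) xs

  -- σ is the prefix standard permutation of a ∷ xs
  -- (Fin index i stands for i+1; σ ⟨$⟩ˡ i is σ⁻¹(i+1))
  IsPrefixStdPerm : (a : A) (xs : List A) → Permutation′ (suc (length xs)) → Set
  IsPrefixStdPerm a xs σ = ∀ i j → i Fin.< j →
    prefix a xs (σ ⟨$⟩ˡ i) ≺ prefix a xs (σ ⟨$⟩ˡ j)

  -- α = σ(1) σ(2) ⋯ σ(n): the word of σ with its last entry removed
  alpha : ∀ {n} → Permutation′ (suc n) → List ℕ
  alpha {n} σ = map (λ i → suc (toℕ (σ ⟨$⟩ʳ inject₁ i))) (allFin n)

  data IsTl : List A → Tree A → Set where
    tl-letter : ∀ a → IsTl (a ∷ []) (leaf a)
    tl-word   : ∀ a x xs (σ : Permutation′ (suc (length (x ∷ xs)))) tstar t →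
                IsPrefixStdPerm a (x ∷ xs) σ →
                IsDecTree (alpha σ) tstar →
                fill tstar (a ∷ x ∷ xs) ≡ just (t , []) →
                IsTl (a ∷ x ∷ xs) t

-- Both trees are the Cartesian tree of w for the order ≺ on its nonempty proper
-- prefixes: the complete tree with foliage w whose internal nodes, read from left to
-- right, are the prefixes p₁, …, pₙ, each ≺-above every prefix in its subtrees. Such a
-- tree is unique. For tl(w) this is the definition read through the prefix standard
-- permutation. For lst(w), let w = uv be the standard factorisation. The proper prefixes
-- of w are those of u, then u, then u·p for the proper prefixes p of v. Every proper
-- prefix of w is a prefix of u^ω: its next letter cannot exceed the one of u^ω, by
-- maximality of u, nor fall below it, as v would then be smaller than w. Hence u is the
-- ≺-largest prefix, and p ↦ u·p is ≺-monotone on the prefixes of v; since v is again a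
-- Lyndon word, induction applies to both factors. Throughout, ≺ is computed by the
-- finite test x ≺ y ⇔ xy < yx, or xy = yx and |x| > |y|.

module Submission where

open import Level using (0ℓ)
open import Function using (id)
open import Data.Empty using (⊥; ⊥-elim)
open import Data.Unit using (⊤; tt)
open import Data.Product using (∃; _×_; _,_; proj₁; proj₂)
open import Data.Sum using (_⊎_; inj₁; inj₂)
open import Data.Maybe using (just; nothing)
open import Data.Nat as ℕ using (ℕ; zero; suc; _+_; _∸_; _*_; _%_; _≤_; z≤n; s≤s)
import Data.Nat.Properties as ℕₚ
open import Data.Nat.DivMod using ([m+n]%n≡m%n; m<n⇒m%n≡m)
open import Data.Fin as Fin using (Fin; toℕ; fromℕ<; punchOut; inject₁)
import Data.Fin.Properties as Finₚ
open import Data.Fin.Permutation using (Permutation′; _⟨$⟩ʳ_; _⟨$⟩ˡ_; permutation; inverseʳ; inverseˡ)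
open import Data.List using (List; []; _∷_; [_]; _++_; _∷ʳ_; _∷ʳ′_; initLast; length; take; drop; map; tabulate; allFin)
open import Data.List.Properties
  using (++-assoc; ++-identityʳ; ++-cancelˡ; ++-conicalˡ; ∷-injective; ∷ʳ-injective; length-++; length-++-comm;
         length-++-≤ˡ; length-++-≤ʳ; length-take; length-tabulate; map-++; map-∘; map-id; map-tabulate; take++drop≡id)
open import Data.List.Membership.Propositional using (_∈_)
open import Data.List.Membership.Propositional.Properties using (∈-allFin)
open import Data.List.Relation.Unary.All as All using (All; []; _∷_)
import Data.List.Relation.Unary.All.Properties as Allₚ
open import Data.List.Relation.Unary.Any using (here; there)
open import Data.List.Relation.Binary.Lex.Strict using (base; halt; this; next; <-decidable)
open import Relation.Unary using (Pred)
open import Relation.Binary.Core using (Rel)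
open import Relation.Binary.Definitions using (Asymmetric; Tri; tri<; tri≈; tri>)
open import Relation.Binary.Structures using (IsStrictTotalOrder)
open import Relation.Binary.Structures.Biased using (isStrictTotalOrderᶜ)
open import Relation.Binary.PropositionalEquality
  using (_≡_; _≢_; _≗_; refl; sym; trans; cong; cong₂; subst; subst₂; isEquivalence; module ≡-Reasoning)
open import Relation.Nullary using (Dec; yes; no; ¬_)

open import Defs

module _ {X : Set} where

  ++-split : (p r q s : List X) → p ++ r ≡ q ++ s →
             (∃ λ e → q ≡ p ++ e × r ≡ e ++ s) ⊎ (∃ λ e → p ≡ q ++ e × s ≡ e ++ r)
  ++-split []      r q       s eq = inj₁ (q , refl , eq)
  ++-split (x ∷ p) r []      s eq = inj₂ (x ∷ p , refl , sym eq)
  ++-split (x ∷ p) r (y ∷ q) s eq with refl , eq′ ← ∷-injective eq with ++-split p r q s eq′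
  ... | inj₁ (e , a , b) = inj₁ (e , cong (x ∷_) a , b)
  ... | inj₂ (e , a , b) = inj₂ (e , cong (x ∷_) a , b)

  ≢[]⇒1≤length : {p : List X} → p ≢ [] → 1 ≤ length p
  ≢[]⇒1≤length {[]}    p≢[] = ⊥-elim (p≢[] refl)
  ≢[]⇒1≤length {_ ∷ _} _    = s≤s z≤n

  ++-≢[]ˡ : (p q : List X) → p ≢ [] → p ++ q ≢ []
  ++-≢[]ˡ p q p≢[] pq≡[] = p≢[] (++-conicalˡ p q pq≡[])

  ++-∷-≢[] : ∀ p {x : X} {q} → p ++ x ∷ q ≢ []
  ++-∷-≢[] []      ()
  ++-∷-≢[] (_ ∷ _) ()

  ∷ʳ-≢[] : (p : List X) (c : X) → p ∷ʳ c ≢ []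
  ∷ʳ-≢[] p c pc≡[] = ++-∷-≢[] p pc≡[]

  length-++-<ˡ : (p q : List X) → q ≢ [] → length p ℕ.< length (p ++ q)
  length-++-<ˡ p q q≢[] = subst (length p ℕ.<_) (sym (length-++ p)) (ℕₚ.m<m+n (length p) (≢[]⇒1≤length q≢[]))

  length-++-<ʳ : (p q : List X) → p ≢ [] → length q ℕ.< length (p ++ q)
  length-++-<ʳ p q p≢[] = subst (length q ℕ.<_) (sym (length-++ p)) (ℕₚ.m<n+m (length q) (≢[]⇒1≤length p≢[]))

  factor-length-<ˡ : ∀ {w} (p q : List X) → w ≡ p ++ q → q ≢ [] → length p ℕ.< length w
  factor-length-<ˡ p q refl = length-++-<ˡ p q

  factor-length-<ʳ : ∀ {w} (p q : List X) → w ≡ p ++ q → p ≢ [] → length q ℕ.< length w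
  factor-length-<ʳ p q refl = length-++-<ʳ p q

  length-∷ʳ : (p : List X) (c : X) → length (p ∷ʳ c) ≡ suc (length p)
  length-∷ʳ p c = trans (length-++ p) (ℕₚ.+-comm (length p) 1)

  length-∷ʳ-≤-++ : (u p : List X) (d : X) → u ≢ [] → length (p ∷ʳ d) ≤ length (u ++ p)
  length-∷ʳ-≤-++ u p d u≢[] = subst (_≤ length (u ++ p)) (sym (length-∷ʳ p d)) (length-++-<ʳ u p u≢[])

  infix 4 _⊑_
  _⊑_ : Rel (List X) 0ℓ
  p ⊑ q = ∃ λ r → q ≡ p ++ r

  ⊑-refl : ∀ p → p ⊑ p
  ⊑-refl p = [] , sym (++-identityʳ p)

  ⊑-trans : ∀ {p q r} → p ⊑ q → q ⊑ r → p ⊑ r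
  ⊑-trans {p} (s , refl) (t , refl) = s ++ t , ++-assoc p s t

  p⊑p++q : ∀ p q → p ⊑ p ++ q
  p⊑p++q p q = q , refl

  ⊑-++ˡ : ∀ z {p q} → p ⊑ q → z ++ p ⊑ z ++ q
  ⊑-++ˡ z {p} (r , refl) = r , sym (++-assoc z p r)

  ⊑-++ˡ⁻ : ∀ z {p q} → z ++ p ⊑ z ++ q → p ⊑ q
  ⊑-++ˡ⁻ z {p} {q} (r , eq) = r , ++-cancelˡ z q (p ++ r) (trans eq (++-assoc z p r))

  ⊑⇒length≤ : ∀ {p q} → p ⊑ q → length p ≤ length q
  ⊑⇒length≤ {p} (r , refl) = length-++-≤ˡ p

  ⊑-by-length : ∀ {p q z} → p ⊑ z → q ⊑ z → length p ≤ length q → p ⊑ q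
  ⊑-by-length {p} {q} (r , refl) (s , eq) p≤q with ++-split p r q s eq
  ... | inj₁ (e , q≡pe , _)     = e , q≡pe
  ... | inj₂ ([] , p≡q[] , _)   = [] , trans (sym (++-identityʳ q)) (trans (sym p≡q[]) (sym (++-identityʳ p)))
  ... | inj₂ (x ∷ e , p≡qxe , _) = ⊥-elim (ℕₚ.<⇒≱ (factor-length-<ˡ q (x ∷ e) p≡qxe (λ ())) p≤q)

  ⊑-comparable : ∀ {p q z} → p ⊑ z → q ⊑ z → p ⊑ q ⊎ q ⊑ p
  ⊑-comparable {p} {q} p⊑z q⊑z with ℕₚ.≤-total (length p) (length q)
  ... | inj₁ p≤q = inj₁ (⊑-by-length p⊑z q⊑z p≤q)
  ... | inj₂ q≤p = inj₂ (⊑-by-length q⊑z p⊑z q≤p)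

  ++-injective : (p r q s : List X) → p ++ r ≡ q ++ s → length p ≡ length q → p ≡ q × r ≡ s
  ++-injective []      r []      s eq _ = refl , eq
  ++-injective (x ∷ p) r (y ∷ q) s eq l with refl , eq′ ← ∷-injective eq
    with refl , r≡s ← ++-injective p r q s eq′ (ℕₚ.suc-injective l) = refl , r≡s

  take-length-++ : (p q : List X) → take (length p) (p ++ q) ≡ p
  take-length-++ []      q = refl
  take-length-++ (x ∷ p) q = cong (x ∷_) (take-length-++ p q)

  length-take-≤ : ∀ i (p : List X) → i ≤ length p → length (take i p) ≡ i
  length-take-≤ i p i≤p = trans (length-take i p) (ℕₚ.m≤n⇒m⊓n≡m i≤p)

  drop-≢[] : ∀ i (p : List X) → i ℕ.< length p → drop i p ≢ []
  drop-≢[] zero    (_ ∷ _) _       ()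
  drop-≢[] (suc i) (_ ∷ p) (s≤s i<p) = drop-≢[] i p i<p

-- Cartesian trees

data IsCartesian {A K : Set} (R : Rel K 0ℓ) : List K → List A → Tree A → Set where
  cleaf : ∀ a → IsCartesian R [] [ a ] (leaf a)
  cnode : ∀ {ks₁ k ks₂ w₁ w₂ t₁ t₂} → All (λ j → R j k) ks₁ → All (λ j → R j k) ks₂ →
          IsCartesian R ks₁ w₁ t₁ → IsCartesian R ks₂ w₂ t₂ →
          IsCartesian R (ks₁ ++ k ∷ ks₂) (w₁ ++ w₂) (node t₁ t₂)

module _ {A K : Set} {R : Rel K 0ℓ} where

  IsCartesian-length : ∀ {ks w t} → IsCartesian {A} R ks w t → length w ≡ suc (length ks)
  IsCartesian-length (cleaf a) = refl
  IsCartesian-length (cnode {ks₁} {w₁ = w₁} _ _ c₁ c₂) =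
    trans (length-++ w₁) (trans (cong₂ _+_ (IsCartesian-length c₁) (IsCartesian-length c₂))
      (cong suc (sym (length-++ ks₁))))

  module _ (R-asym : Asymmetric R) where

    private
      All-middle : ∀ {P : Pred K 0ℓ} ks {k ks′} → All P (ks ++ k ∷ ks′) → P k
      All-middle ks ps = All.head (Allₚ.++⁻ʳ ks ps)

      max-before-max : ∀ {ks₁ k ks₂ ks₁′ k′ ks₂′} e x → All (λ j → R j k) ks₂ → All (λ j → R j k′) ks₁′ →
                       ks₁′ ≡ ks₁ ++ x ∷ e → k ∷ ks₂ ≡ (x ∷ e) ++ k′ ∷ ks₂′ → ∀ {B : Set} → B
      max-before-max {ks₁} e x a₂ a₁′ e₁ e₂ with refl , e₃ ← ∷-injective e₂ =
        ⊥-elim (R-asym (All-middle ks₁ (subst (All _) e₁ a₁′)) (All-middle e (subst (All _) e₃ a₂)))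

    strict-max-position : ∀ {ks₁ k ks₂ ks₁′ k′ ks₂′} →
      All (λ j → R j k) ks₁ → All (λ j → R j k) ks₂ → All (λ j → R j k′) ks₁′ → All (λ j → R j k′) ks₂′ →
      ks₁ ++ k ∷ ks₂ ≡ ks₁′ ++ k′ ∷ ks₂′ → ks₁ ≡ ks₁′ × k ≡ k′ × ks₂ ≡ ks₂′
    strict-max-position {ks₁} {k} {ks₂} {ks₁′} {k′} {ks₂′} a₁ a₂ a₁′ a₂′ eq
      with ++-split ks₁ (k ∷ ks₂) ks₁′ (k′ ∷ ks₂′) eq
    ... | inj₁ ([] , e₁ , e₂) with refl , refl ← ∷-injective e₂ = sym (trans e₁ (++-identityʳ ks₁)) , refl , refl
    ... | inj₁ (x ∷ e , e₁ , e₂) = max-before-max e x a₂ a₁′ e₁ e₂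
    ... | inj₂ ([] , e₁ , e₂) with refl , refl ← ∷-injective e₂ = trans e₁ (++-identityʳ ks₁′) , refl , refl
    ... | inj₂ (x ∷ e , e₁ , e₂) = max-before-max e x a₂′ a₁ e₁ e₂

    IsCartesian-unique : ∀ {ks w t t′} → IsCartesian {A} R ks w t → IsCartesian R ks w t′ → t ≡ t′
    IsCartesian-unique c c′ = go c c′ refl refl
      where
      go : ∀ {ks w t ks′ w′ t′} → IsCartesian {A} R ks w t → IsCartesian R ks′ w′ t′ → ks ≡ ks′ → w ≡ w′ → t ≡ t′
      go (cleaf a) (cleaf .a) _ refl = refl
      go (cleaf a) (cnode {ks₁} _ _ _ _) eq _ = ⊥-elim (++-∷-≢[] ks₁ (sym eq))
      go (cnode {ks₁} _ _ _ _) (cleaf a) eq _ = ⊥-elim (++-∷-≢[] ks₁ eq)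
      go (cnode {w₁ = w₁} {w₂} a₁ a₂ c₁ c₂) (cnode {w₁ = w₁′} {w₂′} a₁′ a₂′ c₁′ c₂′) eq ew
        with refl , refl , refl ← strict-max-position a₁ a₂ a₁′ a₂′ eq
        with refl , refl ← ++-injective w₁ w₂ w₁′ w₂′ ew
               (trans (IsCartesian-length c₁) (sym (IsCartesian-length c₁′)))
        = cong₂ node (go c₁ c₁′ refl refl) (go c₂ c₂′ refl refl)

IsCartesian-relabel : ∀ {A I K₁ K₂ : Set} {R₁ : Rel K₁ 0ℓ} {R₂ : Rel K₂ 0ℓ} {P : Pred I 0ℓ}
  (f : I → K₁) (g : I → K₂) → (∀ {i j} → P i → P j → R₁ (f i) (f j) → R₂ (g i) (g j)) →
  ∀ {is w t} → All P is → IsCartesian {A} R₁ (map f is) w t → IsCartesian R₂ (map g is) w t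
IsCartesian-relabel {A} {I} {R₁ = R₁} {R₂} {P} f g mono ps c = go c _ ps refl
  where
  map-split : ∀ is {ks₁ k ks₂} → map f is ≡ ks₁ ++ k ∷ ks₂ →
              ∃ λ is₁ → ∃ λ i → ∃ λ is₂ → is ≡ is₁ ++ i ∷ is₂ × map f is₁ ≡ ks₁ × f i ≡ k × map f is₂ ≡ ks₂
  map-split (i ∷ is) {[]}    e with refl , e′ ← ∷-injective e = [] , i , is , refl , refl , refl , e′
  map-split (i ∷ is) {_ ∷ _} e with refl , e′ ← ∷-injective e with is₁ , j , is₂ , refl , refl , e″ ← map-split is e′
    = i ∷ is₁ , j , is₂ , refl , refl , e″
  relabel-bound : ∀ {is i} → All P is → P i → All (λ k → R₁ k (f i)) (map f is) → All (λ k → R₂ k (g i)) (map g is)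
  relabel-bound []         _  []         = []
  relabel-bound (pj ∷ pjs) pi (r ∷ rs) = mono pj pi r ∷ relabel-bound pjs pi rs
  go : ∀ {ks w t} → IsCartesian {A} R₁ ks w t → ∀ is → All P is → ks ≡ map f is → IsCartesian R₂ (map g is) w t
  go (cleaf a) [] _ _ = cleaf a
  go (cnode {ks₁} {k} {ks₂} a₁ a₂ c₁ c₂) is ps e
    with is₁ , i , is₂ , refl , refl , refl , refl ← map-split is (sym e)
    with p₁ , pi ∷ p₂ ← Allₚ.++⁻ is₁ ps
    = subst (λ ks → IsCartesian R₂ ks _ _) (sym (map-++ g is₁ (i ∷ is₂)))
        (cnode (relabel-bound p₁ pi a₁) (relabel-bound p₂ pi a₂) (go c₁ is₁ p₁ refl) (go c₂ is₂ p₂ refl))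

module _ {A : Set} where

  fill-bnode : ∀ l m r (w : List A) {t rest} → fill (bnode l m r) w ≡ just (t , rest) →
               ∃ λ t₁ → ∃ λ w′ → ∃ λ t₂ → fill l w ≡ just (t₁ , w′) × fill r w′ ≡ just (t₂ , rest) × t ≡ node t₁ t₂
  fill-bnode l m r w eq with fill l w in eq₁
  fill-bnode l m r w () | nothing
  ... | just (t₁ , w′) with fill r w′ in eq₂
  fill-bnode l m r w () | just _ | nothing
  fill-bnode l m r w refl | just (t₁ , w′) | just (t₂ , _) = t₁ , w′ , t₂ , refl , eq₂ , refl

  fill⇒IsCartesian : ∀ {α t*} → IsDecTree α t* → ∀ (w : List A) {t rest} → fill t* w ≡ just (t , rest) →
                     ∃ λ w₁ → w ≡ w₁ ++ rest × IsCartesian ℕ._<_ α w₁ t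
  fill⇒IsCartesian dempty (a ∷ w) refl = [ a ] , refl , cleaf a
  fill⇒IsCartesian (dnode {m = m} {l} {r} a₁ a₂ dl dr) w eq
    with t₁ , w′ , t₂ , e₁ , e₂ , refl ← fill-bnode l m r w eq
    with w₁ , refl , c₁ ← fill⇒IsCartesian dl w e₁
    with w₂ , refl , c₂ ← fill⇒IsCartesian dr w′ e₂
    = w₁ ++ w₂ , sym (++-assoc w₁ w₂ _) , cnode a₁ a₂ c₁ c₂

  IsCartesian⇒fill : ∀ {α} {w : List A} {t} → IsCartesian ℕ._<_ α w t →
                     ∃ λ t* → IsDecTree α t* × (∀ rest → fill t* (w ++ rest) ≡ just (t , rest))
  IsCartesian⇒fill (cleaf a) = empty , dempty , λ _ → refl
  IsCartesian⇒fill (cnode {k = m} {w₁ = w₁} {w₂} {t₁} {t₂} a₁ a₂ c₁ c₂)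
    with l , dl , fill₁ ← IsCartesian⇒fill c₁ | r , dr , fill₂ ← IsCartesian⇒fill c₂
    = bnode l m r , dnode a₁ a₂ dl dr , fills
    where
    fills : ∀ rest → fill (bnode l m r) ((w₁ ++ w₂) ++ rest) ≡ just (node t₁ t₂ , rest)
    fills rest rewrite ++-assoc w₁ w₂ rest | fill₁ (w₂ ++ rest) | fill₂ rest = refl

greatest-≤ : {P : ℕ → Set} → (∀ j → Dec (P j)) → P 1 → ∀ m →
             ∃ λ i → 1 ≤ i × i ≤ suc m × P i × (∀ j → i ℕ.< j → j ≤ suc m → ¬ P j)
greatest-≤ P? P1 zero = 1 , s≤s z≤n , s≤s z≤n , P1 , λ j 1<j j≤1 _ → ℕₚ.<⇒≱ 1<j j≤1
greatest-≤ {P} P? P1 (suc m) with P? (suc (suc m))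
... | yes Pm+2 = suc (suc m) , s≤s z≤n , ℕₚ.≤-refl , Pm+2 , λ j m+2<j j≤m+2 _ → ℕₚ.<⇒≱ m+2<j j≤m+2
... | no ¬Pm+2 with i , 1≤i , i≤m+1 , Pi , above-i ← greatest-≤ P? P1 m =
  i , 1≤i , ℕₚ.m≤n⇒m≤1+n i≤m+1 , Pi , above-i′
  where
  above-i′ : ∀ j → i ℕ.< j → j ≤ suc (suc m) → ¬ P j
  above-i′ j i<j j≤m+2 with ℕₚ.m≤n⇒m<n∨m≡n j≤m+2
  ... | inj₁ j<m+2 = above-i j i<j (ℕₚ.≤-pred j<m+2)
  ... | inj₂ refl  = ¬Pm+2

Fin-injective⇒surjective : ∀ {n} {f : Fin n → Fin n} → (∀ {k l} → f k ≡ f l → k ≡ l) → ∀ y → ∃ λ k → f k ≡ y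
Fin-injective⇒surjective {suc m} {f} f-inj y with Finₚ.any? (λ k → f k Finₚ.≟ y)
... | yes found = found
... | no  none  = ⊥-elim (ℕₚ.<-irrefl refl (Finₚ.injective⇒≤ {f = f-avoiding-y} f-avoiding-y-injective))
  where
  y∉image : ∀ k → y ≢ f k
  y∉image k y≡fk = none (k , sym y≡fk)
  f-avoiding-y : Fin (suc m) → Fin m
  f-avoiding-y k = punchOut (y∉image k)
  f-avoiding-y-injective : ∀ {k l} → f-avoiding-y k ≡ f-avoiding-y l → k ≡ l
  f-avoiding-y-injective {k} {l} eq = f-inj (Finₚ.punchOut-injective (y∉image k) (y∉image l) eq)

⟨$⟩ˡ-injective : ∀ {n} (π : Permutation′ n) {i j} → π ⟨$⟩ˡ i ≡ π ⟨$⟩ˡ j → i ≡ j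
⟨$⟩ˡ-injective π eq = trans (sym (inverseʳ π)) (trans (cong (π ⟨$⟩ʳ_) eq) (inverseʳ π))

module RankPermutation {n} {_◁_ : Rel (Fin n) 0ℓ} (◁-isSTO : IsStrictTotalOrder _≡_ _◁_) where

  open IsStrictTotalOrder ◁-isSTO using (compare; irrefl; _<?_) renaming (trans to ◁-trans)

  countBelow : Fin n → List (Fin n) → ℕ
  countBelow k []       = 0
  countBelow k (j ∷ js) with j <? k
  ... | yes _ = suc (countBelow k js)
  ... | no  _ = countBelow k js

  countBelow-mono : ∀ {k l} → k ◁ l → ∀ js → countBelow k js ℕ.≤ countBelow l js
  countBelow-mono k◁l [] = z≤n
  countBelow-mono {k} {l} k◁l (j ∷ js) with j <? k | j <? l
  ... | yes _   | yes _   = s≤s (countBelow-mono k◁l js)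
  ... | yes j◁k | no  j⋪l = ⊥-elim (j⋪l (◁-trans j◁k k◁l))
  ... | no  _   | yes _   = ℕₚ.m≤n⇒m≤1+n (countBelow-mono k◁l js)
  ... | no  _   | no  _   = countBelow-mono k◁l js

  countBelow-<-mono : ∀ {k l} → k ◁ l → ∀ {js} → k ∈ js → countBelow k js ℕ.< countBelow l js
  countBelow-<-mono {k} {l} k◁l {k ∷ js} (here refl) with k <? k | k <? l
  ... | yes k◁k | _       = ⊥-elim (irrefl refl k◁k)
  ... | no  _   | yes _   = s≤s (countBelow-mono k◁l js)
  ... | no  _   | no  k⋪l = ⊥-elim (k⋪l k◁l)
  countBelow-<-mono {k} {l} k◁l {j ∷ js} (there k∈js) with j <? k | j <? l
  ... | yes _   | yes _   = s≤s (countBelow-<-mono k◁l k∈js)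
  ... | yes j◁k | no  j⋪l = ⊥-elim (j⋪l (◁-trans j◁k k◁l))
  ... | no  _   | yes _   = ℕₚ.m≤n⇒m≤1+n (countBelow-<-mono k◁l k∈js)
  ... | no  _   | no  _   = countBelow-<-mono k◁l k∈js

  countBelow-≤-length : ∀ k js → countBelow k js ℕ.≤ length js
  countBelow-≤-length k [] = z≤n
  countBelow-≤-length k (j ∷ js) with j <? k
  ... | yes _ = s≤s (countBelow-≤-length k js)
  ... | no  _ = ℕₚ.m≤n⇒m≤1+n (countBelow-≤-length k js)

  countBelow-<-length : ∀ {k js} → k ∈ js → countBelow k js ℕ.< length js
  countBelow-<-length {k} {k ∷ js} (here refl) with k <? k
  ... | yes k◁k = ⊥-elim (irrefl refl k◁k)
  ... | no  _   = s≤s (countBelow-≤-length k js)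
  countBelow-<-length {k} {j ∷ js} (there k∈js) with j <? k
  ... | yes _ = s≤s (countBelow-<-length k∈js)
  ... | no  _ = ℕₚ.m≤n⇒m≤1+n (countBelow-<-length k∈js)

  rank : Fin n → Fin n
  rank k = fromℕ< (subst (countBelow k (allFin n) ℕ.<_) (length-tabulate id) (countBelow-<-length (∈-allFin k)))

  rank-mono : ∀ {k l} → k ◁ l → rank k Fin.< rank l
  rank-mono {k} {l} k◁l = subst₂ ℕ._<_ (sym (Finₚ.toℕ-fromℕ< _)) (sym (Finₚ.toℕ-fromℕ< _))
    (countBelow-<-mono k◁l (∈-allFin k))

  rank-injective : ∀ {k l} → rank k ≡ rank l → k ≡ l
  rank-injective {k} {l} eq with compare k l
  ... | tri< k◁l _ _ = ⊥-elim (ℕₚ.<-irrefl (cong toℕ eq) (rank-mono k◁l))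
  ... | tri≈ _ k≡l _ = k≡l
  ... | tri> _ _ l◁k = ⊥-elim (ℕₚ.<-irrefl (cong toℕ (sym eq)) (rank-mono l◁k))

  rankPermutation : Permutation′ n
  rankPermutation = permutation rank (λ y → proj₁ (rank-surjective y)) (λ y → proj₂ (rank-surjective y))
    (λ k → rank-injective (proj₂ (rank-surjective (rank k))))
    where rank-surjective = Fin-injective⇒surjective rank-injective

  rankPermutation⁻¹-mono : ∀ {i j} → i Fin.< j → (rankPermutation ⟨$⟩ˡ i) ◁ (rankPermutation ⟨$⟩ˡ j)
  rankPermutation⁻¹-mono {i} {j} i<j with compare (rankPermutation ⟨$⟩ˡ i) (rankPermutation ⟨$⟩ˡ j)
  ... | tri< k◁l _ _ = k◁l
  ... | tri≈ _ k≡l _ = ⊥-elim (ℕₚ.<-irrefl (cong toℕ (⟨$⟩ˡ-injective rankPermutation k≡l)) i<j)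
  ... | tri> _ _ l◁k = ⊥-elim (ℕₚ.<-asym i<j (subst₂ Fin._<_ (inverseʳ rankPermutation) (inverseʳ rankPermutation) (rank-mono l◁k)))

module OrderedAlphabet {A : Set} {_<_ : Rel A 0ℓ} (<-isSTO : IsStrictTotalOrder _≡_ _<_) where

  open Words _<_
  open IsStrictTotalOrder <-isSTO using (compare; _≟_; _<?_) renaming (trans to <-trans; irrefl to <-irrefl)

  <-irrefl′ : ∀ {a} → a < a → ⊥
  <-irrefl′ = <-irrefl refl

  infix 4 _<ᵐ_ _≤ᵐ_

  -- Mismatch order: p has the smaller letter at the first position where p and q differ;
  -- unlike <ʷ, it never relates a word to its extensions.
  data _<ᵐ_ : Rel (List A) 0ℓ where
    here  : ∀ {a b p q} → a < b → a ∷ p <ᵐ b ∷ q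
    there : ∀ {a p q} → p <ᵐ q → a ∷ p <ᵐ a ∷ q

  _≤ᵐ_ : Rel (List A) 0ℓ
  p ≤ᵐ q = p <ᵐ q ⊎ p ≡ q

  <ᵐ-++ˡ : ∀ z {p q} → p <ᵐ q → z ++ p <ᵐ z ++ q
  <ᵐ-++ˡ []      p<q = p<q
  <ᵐ-++ˡ (_ ∷ z) p<q = there (<ᵐ-++ˡ z p<q)

  <ᵐ-++ʳ : ∀ {p q} → p <ᵐ q → ∀ r s → p ++ r <ᵐ q ++ s
  <ᵐ-++ʳ (here a<b)  r s = here a<b
  <ᵐ-++ʳ (there p<q) r s = there (<ᵐ-++ʳ p<q r s)

  <ᵐ-⊑ : ∀ {p q p′ q′} → p <ᵐ q → p ⊑ p′ → q ⊑ q′ → p′ <ᵐ q′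
  <ᵐ-⊑ p<q (r , refl) (s , refl) = <ᵐ-++ʳ p<q r s

  <ᵐ-++ˡ⁻ : ∀ z {p q} → z ++ p <ᵐ z ++ q → p <ᵐ q
  <ᵐ-++ˡ⁻ []      p<q         = p<q
  <ᵐ-++ˡ⁻ (_ ∷ z) (here a<a)  = ⊥-elim (<-irrefl′ a<a)
  <ᵐ-++ˡ⁻ (_ ∷ z) (there p<q) = <ᵐ-++ˡ⁻ z p<q

  <ᵐ-trans : ∀ {p q r} → p <ᵐ q → q <ᵐ r → p <ᵐ r
  <ᵐ-trans (here a<b)  (here b<c)  = here (<-trans a<b b<c)
  <ᵐ-trans (here a<b)  (there _)   = here a<b
  <ᵐ-trans (there _)   (here b<c)  = here b<c
  <ᵐ-trans (there p<q) (there q<r) = there (<ᵐ-trans p<q q<r)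

  <ᵐ-irrefl : ∀ {p} → p <ᵐ p → ⊥
  <ᵐ-irrefl (here a<a)  = <-irrefl′ a<a
  <ᵐ-irrefl (there p<p) = <ᵐ-irrefl p<p

  <ᵐ-asym : ∀ {p q} → p <ᵐ q → q <ᵐ p → ⊥
  <ᵐ-asym p<q q<p = <ᵐ-irrefl (<ᵐ-trans p<q q<p)

  <ᵐ⇒⋢ : ∀ {p q} → p <ᵐ q → q ⊑ p → ⊥
  <ᵐ⇒⋢ (here a<b)  (_ , refl) = <-irrefl′ a<b
  <ᵐ⇒⋢ (there p<q) (r , refl) = <ᵐ⇒⋢ p<q (r , refl)

  <ᵐ-trichotomy : ∀ p q → length p ≡ length q → p <ᵐ q ⊎ p ≡ q ⊎ q <ᵐ p
  <ᵐ-trichotomy []      []      _ = inj₂ (inj₁ refl)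
  <ᵐ-trichotomy (a ∷ p) (b ∷ q) l with compare a b
  ... | tri< a<b _ _ = inj₁ (here a<b)
  ... | tri> _ _ b<a = inj₂ (inj₂ (here b<a))
  ... | tri≈ _ refl _ with <ᵐ-trichotomy p q (ℕₚ.suc-injective l)
  ...   | inj₁ p<q        = inj₁ (there p<q)
  ...   | inj₂ (inj₁ refl) = inj₂ (inj₁ refl)
  ...   | inj₂ (inj₂ q<p) = inj₂ (inj₂ (there q<p))

  <ᵐ-witness : ∀ {p q} → p <ᵐ q →
               ∃ λ c → ∃ λ a → ∃ λ b → ∃ λ r → ∃ λ s → a < b × p ≡ c ++ a ∷ r × q ≡ c ++ b ∷ s
  <ᵐ-witness (here {a} {b} {r} {s} a<b) = [] , a , b , r , s , a<b , refl , refl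
  <ᵐ-witness (there {x} p<q) with c , a , b , r , s , a<b , refl , refl ← <ᵐ-witness p<q
    = x ∷ c , a , b , r , s , a<b , refl , refl

  <ᵐ⇒<ʷ : ∀ {p q} → p <ᵐ q → p <ʷ q
  <ᵐ⇒<ʷ (here a<b)  = this a<b
  <ᵐ⇒<ʷ (there p<q) = next refl (<ᵐ⇒<ʷ p<q)

  <ʷ⇒<ᵐ⊎proper⊑ : ∀ {p q} → p <ʷ q → p <ᵐ q ⊎ ∃ λ e → e ≢ [] × q ≡ p ++ e
  <ʷ⇒<ᵐ⊎proper⊑ (base ())
  <ʷ⇒<ᵐ⊎proper⊑ (halt {y} {ys}) = inj₂ (y ∷ ys , (λ ()) , refl)
  <ʷ⇒<ᵐ⊎proper⊑ (this a<b) = inj₁ (here a<b)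
  <ʷ⇒<ᵐ⊎proper⊑ (next refl p<q) with <ʷ⇒<ᵐ⊎proper⊑ p<q
  ... | inj₁ p<ᵐq = inj₁ (there p<ᵐq)
  ... | inj₂ (e , e≢[] , refl) = inj₂ (e , e≢[] , refl)

  ≤ᵐ-++ˡ : ∀ z {p q} → p ≤ᵐ q → z ++ p ≤ᵐ z ++ q
  ≤ᵐ-++ˡ z (inj₁ p<q)  = inj₁ (<ᵐ-++ˡ z p<q)
  ≤ᵐ-++ˡ z (inj₂ refl) = inj₂ refl

  ≤ᵐ-++ʳ : ∀ {p q} → p ≤ᵐ q → ∀ r → p ++ r ≤ᵐ q ++ r
  ≤ᵐ-++ʳ (inj₁ p<q)  r = inj₁ (<ᵐ-++ʳ p<q r r)
  ≤ᵐ-++ʳ (inj₂ refl) r = inj₂ refl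

  <ᵐ-∷ʳ-raise : ∀ p q {d c} → p ∷ʳ d <ᵐ q ∷ʳ d → length q ℕ.< length p → d < c → p ∷ʳ c <ᵐ q ∷ʳ c
  <ᵐ-∷ʳ-raise (a ∷ p) []      (here a<d)  _ d<c = here (<-trans a<d d<c)
  <ᵐ-∷ʳ-raise (a ∷ p) (b ∷ q) (here a<b)  _ _   = here a<b
  <ᵐ-∷ʳ-raise (a ∷ p) (a ∷ q) (there lt) q<p d<c = there (<ᵐ-∷ʳ-raise p q lt (ℕₚ.≤-pred q<p) d<c)

  infixr 8 _^_
  _^_ : List A → ℕ → List A
  u ^ zero  = []
  u ^ suc k = u ++ u ^ k

  ^-+ : ∀ u m n → u ^ (m + n) ≡ u ^ m ++ u ^ n
  ^-+ u zero    n = refl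
  ^-+ u (suc m) n = trans (cong (u ++_) (^-+ u m n)) (sym (++-assoc u (u ^ m) (u ^ n)))

  ^-comm : ∀ u m → u ++ u ^ m ≡ u ^ m ++ u
  ^-comm u zero    = ++-identityʳ u
  ^-comm u (suc m) = trans (cong (u ++_) (^-comm u m)) (sym (++-assoc u (u ^ m) u))

  length-^ : ∀ u k → length (u ^ k) ≡ k * length u
  length-^ u zero    = refl
  length-^ u (suc k) = trans (length-++ u) (cong (length u +_) (length-^ u k))

  -- Prefixes of powers: p ⊑* u says that p is a prefix of u^ω.

  infix 4 _⊑*_
  _⊑*_ : Rel (List A) 0ℓ
  p ⊑* u = ∃ λ k → p ⊑ u ^ k

  ⊑-⊑*-trans : ∀ {p q u} → q ⊑ p → p ⊑* u → q ⊑* u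
  ⊑-⊑*-trans q⊑p (k , p⊑uᵏ) = k , ⊑-trans q⊑p p⊑uᵏ

  u⊑*u : ∀ u → u ⊑* u
  u⊑*u u = 1 , [] , refl

  ⊑*-++ˡ : ∀ {p u} → p ⊑* u → u ++ p ⊑* u
  ⊑*-++ˡ {u = u} (k , p⊑uᵏ) = suc k , ⊑-++ˡ u p⊑uᵏ

  ⊑*-comparable : ∀ {p q u} → p ⊑* u → q ⊑* u → p ⊑ q ⊎ q ⊑ p
  ⊑*-comparable {u = u} (k , p⊑uᵏ) (l , q⊑uˡ) =
    ⊑-comparable (⊑-trans p⊑uᵏ (u ^ l , ^-+ u k l))
                 (⊑-trans q⊑uˡ (u ^ k , trans (cong (u ^_) (ℕₚ.+-comm k l)) (^-+ u l k)))

  ⊑*-by-length : ∀ {p q u} → p ⊑* u → q ⊑* u → length p ≤ length q → p ⊑ q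
  ⊑*-by-length {p} p⊑*u q⊑*u p≤q with ⊑*-comparable p⊑*u q⊑*u
  ... | inj₁ p⊑q = p⊑q
  ... | inj₂ q⊑p = ⊑-by-length (⊑-refl p) q⊑p p≤q

  module PowerPrefixes {u : List A} (u≢[] : u ≢ []) where

    ⊑*-++ˡ⁻ : ∀ {p} → u ++ p ⊑* u → p ⊑* u
    ⊑*-++ˡ⁻ {p} (zero , r , eq) = ⊥-elim (u≢[] (++-conicalˡ u p (++-conicalˡ (u ++ p) r (sym eq))))
    ⊑*-++ˡ⁻ (suc k , uᵏ⁺¹⊒up) = k , ⊑-++ˡ⁻ u uᵏ⁺¹⊒up

    ⊑*-^ˡ⁻ : ∀ m {p} → u ^ m ++ p ⊑* u → p ⊑* u
    ⊑*-^ˡ⁻ zero    p⊑*u = p⊑*u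
    ⊑*-^ˡ⁻ (suc m) {p} ump⊑*u = ⊑*-^ˡ⁻ m (⊑*-++ˡ⁻ (subst (_⊑* u) (++-assoc u (u ^ m) p) ump⊑*u))

    ⊑*-decompose : ∀ {p} → p ⊑* u → ∃ λ m → ∃ λ t → ∃ λ g → p ≡ u ^ m ++ t × u ≡ t ++ g × g ≢ []
    ⊑*-decompose (k , p⊑uᵏ) = go k p⊑uᵏ
      where
      go : ∀ k {p} → p ⊑ u ^ k → ∃ λ m → ∃ λ t → ∃ λ g → p ≡ u ^ m ++ t × u ≡ t ++ g × g ≢ []
      go zero    {[]} _ = 0 , [] , u , refl , refl , u≢[]
      go (suc k) {p} p⊑uᵏ⁺¹ with ℕₚ.<-≤-connex (length p) (length u)
      ... | inj₁ p<u = 0 , p , g , refl , u≡pg , g≢[]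
        where
        p⊑u = ⊑-by-length p⊑uᵏ⁺¹ (p⊑p++q u (u ^ k)) (ℕₚ.<⇒≤ p<u)
        g = proj₁ p⊑u
        u≡pg = proj₂ p⊑u
        g≢[] : g ≢ []
        g≢[] g≡[] = ℕₚ.<-irrefl (cong length (sym (trans u≡pg (trans (cong (p ++_) g≡[]) (++-identityʳ p))))) p<u
      ... | inj₂ u≤p with ⊑-by-length (p⊑p++q u (u ^ k)) p⊑uᵏ⁺¹ u≤p
      ...   | p′ , refl with m , t , g , refl , u≡tg , g≢[] ← go k (⊑-++ˡ⁻ u p⊑uᵏ⁺¹)
        = suc m , t , g , sym (++-assoc u (u ^ m) t) , u≡tg , g≢[]

    ⊑*-extend : ∀ {p} → p ⊑* u → ∃ λ d → p ∷ʳ d ⊑* u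
    ⊑*-extend {p} p⊑*u with ⊑*-decompose p⊑*u
    ... | m , t , [] , _ , _ , g≢[] = ⊥-elim (g≢[] refl)
    ... | m , t , d ∷ g , refl , u≡tdg , _ = d , suc m , g , uᵐ⁺¹≡ptdg
      where
      open ≡-Reasoning
      uᵐ⁺¹≡ptdg : u ++ u ^ m ≡ ((u ^ m ++ t) ∷ʳ d) ++ g
      uᵐ⁺¹≡ptdg = begin
        u ++ u ^ m              ≡⟨ ^-comm u m ⟩
        u ^ m ++ u              ≡⟨ cong (u ^ m ++_) u≡tdg ⟩
        u ^ m ++ t ++ d ∷ g     ≡⟨ sym (++-assoc (u ^ m) t (d ∷ g)) ⟩
        (u ^ m ++ t) ++ d ∷ g   ≡⟨ sym (++-assoc (u ^ m ++ t) [ d ] g) ⟩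
        ((u ^ m ++ t) ∷ʳ d) ++ g ∎

  Lyndon⇒<ᵐ-suffix : ∀ {w} → Lyndon w → ∀ s₁ s₂ → w ≡ s₁ ++ s₂ → s₁ ≢ [] → s₂ ≢ [] → w <ᵐ s₂
  Lyndon⇒<ᵐ-suffix {w} (_ , w<suffix) s₁ s₂ w≡s₁s₂ s₁≢[] s₂≢[]
    with <ʷ⇒<ᵐ⊎proper⊑ (w<suffix s₁ s₂ s₁≢[] s₂≢[] w≡s₁s₂)
  ... | inj₁ w<s₂ = w<s₂
  ... | inj₂ (e , _ , refl) = ⊥-elim (ℕₚ.<⇒≱ (factor-length-<ʳ s₁ (w ++ e) w≡s₁s₂ s₁≢[]) (length-++-≤ˡ w))

  Lyndon-suffix-≮ᵐ : ∀ {w s₁ s₂} → Lyndon w → w ≡ s₁ ++ s₂ → s₁ ≢ [] → s₂ ≢ [] → s₂ <ᵐ w → ⊥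
  Lyndon-suffix-≮ᵐ lw eq s₁≢[] s₂≢[] = <ᵐ-asym (Lyndon⇒<ᵐ-suffix lw _ _ eq s₁≢[] s₂≢[])

  Lyndon-suffix-⋢ : ∀ {w s₁ s₂} → Lyndon w → w ≡ s₁ ++ s₂ → s₁ ≢ [] → s₂ ≢ [] → s₂ ⊑ w → ⊥
  Lyndon-suffix-⋢ lw eq s₁≢[] s₂≢[] = <ᵐ⇒⋢ (Lyndon⇒<ᵐ-suffix lw _ _ eq s₁≢[] s₂≢[])

  infix 4 _≺ᶠ_
  _≺ᶠ_ : Rel (List A) 0ℓ
  p ≺ᶠ q = p ++ q <ᵐ q ++ p ⊎ (p ++ q ≡ q ++ p × length q ℕ.< length p)

  ≺ᶠ-irrefl : ∀ {p} → p ≺ᶠ p → ⊥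
  ≺ᶠ-irrefl (inj₁ pp<pp)    = <ᵐ-irrefl pp<pp
  ≺ᶠ-irrefl (inj₂ (_ , p<p)) = ℕₚ.<-irrefl refl p<p

  ≺ᶠ-extension⁻ : ∀ a e → a ≺ᶠ a ++ e → a ++ e <ᵐ e ++ a
  ≺ᶠ-extension⁻ a e (inj₁ lt)        = <ᵐ-++ˡ⁻ a (subst (a ++ a ++ e <ᵐ_) (++-assoc a e a) lt)
  ≺ᶠ-extension⁻ a e (inj₂ (_ , ae<a)) = ⊥-elim (ℕₚ.<⇒≱ ae<a (length-++-≤ˡ a))

  ≺ᶠ-truncation⁻ : ∀ b e → b ++ e ≺ᶠ b → e ++ b ≤ᵐ b ++ e
  ≺ᶠ-truncation⁻ b e (inj₁ lt)            = inj₁ (<ᵐ-++ˡ⁻ b (subst₂ _<ᵐ_ (++-assoc b e b) refl lt))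
  ≺ᶠ-truncation⁻ b e (inj₂ (beb≡bbe , _)) = inj₂ (++-cancelˡ b _ _ (trans (sym (++-assoc b e b)) beb≡bbe))

  ≺ᶠ-extension⁺ : ∀ a e → a ++ e <ᵐ e ++ a → a ≺ᶠ a ++ e
  ≺ᶠ-extension⁺ a e ae<ea = inj₁ (subst (a ++ a ++ e <ᵐ_) (sym (++-assoc a e a)) (<ᵐ-++ˡ a ae<ea))

  ≺ᶠ-truncation⁺ : ∀ b e → e ≢ [] → e ++ b ≤ᵐ b ++ e → b ++ e ≺ᶠ b
  ≺ᶠ-truncation⁺ b e _ (inj₁ eb<be) = inj₁ (subst₂ _<ᵐ_ (sym (++-assoc b e b)) refl (<ᵐ-++ˡ b eb<be))
  ≺ᶠ-truncation⁺ b e e≢[] (inj₂ eb≡be) = inj₂ (trans (++-assoc b e b) (cong (b ++_) eb≡be) , length-++-<ˡ b e e≢[])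

  module LyndonPowerPrefixes {u : List A} (u≢[] : u ≢ []) (lu : Lyndon u) where

    open PowerPrefixes u≢[]

    factor-++-<ᵐ : ∀ t g → u ≡ t ++ g → t ≢ [] → g ≢ [] → t ++ u <ᵐ u ++ t
    factor-++-<ᵐ t g u≡tg t≢[] g≢[] = subst₂ _<ᵐ_ (cong (t ++_) (++-identityʳ u))
      (trans (sym (++-assoc t g t)) (cong (_++ t) (sym u≡tg)))
      (<ᵐ-++ˡ t (<ᵐ-++ʳ (Lyndon⇒<ᵐ-suffix lu t g u≡tg t≢[] g≢[]) [] t))

    ⊑*⇒++u-≤ᵐ : ∀ {e} → e ⊑* u → e ++ u ≤ᵐ u ++ e
    ⊑*⇒++u-≤ᵐ {e} e⊑*u with ⊑*-decompose e⊑*u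
    ... | m , [] , g , refl , _ , _ = inj₂ (begin
          (u ^ m ++ []) ++ u ≡⟨ cong (_++ u) (++-identityʳ (u ^ m)) ⟩
          u ^ m ++ u         ≡⟨ sym (^-comm u m) ⟩
          u ++ u ^ m         ≡⟨ cong (u ++_) (sym (++-identityʳ (u ^ m))) ⟩
          u ++ u ^ m ++ []   ∎)
      where open ≡-Reasoning
    ... | m , x ∷ t , g , refl , u≡tg , g≢[] =
          inj₁ (subst₂ _<ᵐ_ (sym (++-assoc (u ^ m) (x ∷ t) u)) uᵐu-comm
                 (<ᵐ-++ˡ (u ^ m) (factor-++-<ᵐ (x ∷ t) g u≡tg (λ ()) g≢[])))
      where
      open ≡-Reasoning
      uᵐu-comm : u ^ m ++ u ++ x ∷ t ≡ u ++ u ^ m ++ x ∷ t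
      uᵐu-comm = begin
        u ^ m ++ u ++ x ∷ t   ≡⟨ sym (++-assoc (u ^ m) u (x ∷ t)) ⟩
        (u ^ m ++ u) ++ x ∷ t ≡⟨ cong (_++ x ∷ t) (sym (^-comm u m)) ⟩
        (u ++ u ^ m) ++ x ∷ t ≡⟨ ++-assoc u (u ^ m) (x ∷ t) ⟩
        u ++ u ^ m ++ x ∷ t   ∎

    ⊑*⇒≺ᶠ : ∀ {a} → a ≢ [] → a ⊑* u → a ≢ u → a ≺ᶠ u
    ⊑*⇒≺ᶠ {a} a≢[] a⊑*u a≢u with ⊑*-comparable a⊑*u (u⊑*u u)
    ... | inj₁ ([] , u≡a[]) = ⊥-elim (a≢u (sym (trans u≡a[] (++-identityʳ a))))
    ... | inj₁ (x ∷ g , u≡ag) = inj₁ (factor-++-<ᵐ a (x ∷ g) u≡ag a≢[] (λ ()))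
    ... | inj₂ ([] , refl) = ⊥-elim (a≢u (++-identityʳ u))
    ... | inj₂ (x ∷ e , refl) with ≤ᵐ-++ˡ u (⊑*⇒++u-≤ᵐ (⊑*-++ˡ⁻ a⊑*u))
    ...   | inj₁ lt = inj₁ (subst₂ _<ᵐ_ (sym (++-assoc u (x ∷ e) u)) refl lt)
    ...   | inj₂ eq = inj₂ (trans (++-assoc u (x ∷ e) u) eq , length-++-<ˡ u (x ∷ e) (λ ()))

    private
      u++-⊑ : ∀ {a} → a ⊑* u → a ⊑ u ++ a
      u++-⊑ {a} a⊑*u = ⊑*-by-length a⊑*u (⊑*-++ˡ a⊑*u) (length-++-≤ʳ a {u})

    ≺ᶠ-++ˡ-extension : ∀ a e → a ⊑* u → a ++ e ⊑* u → a ≺ᶠ a ++ e → u ++ a ≺ᶠ u ++ a ++ e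
    ≺ᶠ-++ˡ-extension a e a⊑*u ae⊑*u a≺ae =
      subst (u ++ a ≺ᶠ_) (++-assoc u a e)
        (≺ᶠ-extension⁺ (u ++ a) e (subst₂ _<ᵐ_ lhs rhs (<ᵐ-++ʳ (≺ᶠ-extension⁻ a e a≺ae) z′ z)))
      where
      open ≡-Reasoning
      z = proj₁ (u++-⊑ a⊑*u)
      z′ = proj₁ (u++-⊑ ae⊑*u)
      lhs : (a ++ e) ++ z′ ≡ (u ++ a) ++ e
      lhs = trans (sym (proj₂ (u++-⊑ ae⊑*u))) (sym (++-assoc u a e))
      rhs : (e ++ a) ++ z ≡ e ++ u ++ a
      rhs = trans (++-assoc e a z) (cong (e ++_) (sym (proj₂ (u++-⊑ a⊑*u))))

    ≺ᶠ-++ˡ-truncation : ∀ b e → e ≢ [] → b ++ e ⊑* u → b ⊑* u → b ++ e ≺ᶠ b → u ++ b ++ e ≺ᶠ u ++ b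
    ≺ᶠ-++ˡ-truncation b e e≢[] be⊑*u b⊑*u be≺b =
      subst (_≺ᶠ u ++ b) (++-assoc u b e) (≺ᶠ-truncation⁺ (u ++ b) e e≢[] (shift (≺ᶠ-truncation⁻ b e be≺b)))
      where
      shift : e ++ b ≤ᵐ b ++ e → e ++ u ++ b ≤ᵐ (u ++ b) ++ e
      shift (inj₁ eb<be) = inj₁ (subst₂ _<ᵐ_ lhs rhs (<ᵐ-++ʳ eb<be z z′))
        where
        z = proj₁ (u++-⊑ b⊑*u)
        z′ = proj₁ (u++-⊑ be⊑*u)
        lhs : (e ++ b) ++ z ≡ e ++ u ++ b
        lhs = trans (++-assoc e b z) (cong (e ++_) (sym (proj₂ (u++-⊑ b⊑*u))))
        rhs : (b ++ e) ++ z′ ≡ (u ++ b) ++ e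
        rhs = trans (sym (proj₂ (u++-⊑ be⊑*u))) (sym (++-assoc u b e))
      shift (inj₂ eb≡be) =
        subst₂ _≤ᵐ_ (++-assoc e u b) (trans (++-assoc u e b) (trans (cong (u ++_) eb≡be) (sym (++-assoc u b e))))
          (≤ᵐ-++ʳ (⊑*⇒++u-≤ᵐ e⊑*u) b)
        where
        e⊑*u : e ⊑* u
        e⊑*u = ⊑-⊑*-trans (b , refl) (subst (_⊑* u) (sym eb≡be) be⊑*u)

    ≺ᶠ-++ˡ : ∀ {a b} → a ⊑* u → b ⊑* u → a ≺ᶠ b → u ++ a ≺ᶠ u ++ b
    ≺ᶠ-++ˡ {a} {b} a⊑*u b⊑*u a≺b with ⊑*-comparable a⊑*u b⊑*u
    ... | inj₁ ([] , refl) = ⊥-elim (≺ᶠ-irrefl {a} (subst (a ≺ᶠ_) (++-identityʳ a) a≺b))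
    ... | inj₁ (x ∷ e , refl) = ≺ᶠ-++ˡ-extension a (x ∷ e) a⊑*u b⊑*u a≺b
    ... | inj₂ ([] , refl) = ⊥-elim (≺ᶠ-irrefl {b} (subst (_≺ᶠ b) (++-identityʳ b) a≺b))
    ... | inj₂ (x ∷ e , refl) = ≺ᶠ-++ˡ-truncation b (x ∷ e) (λ ()) a⊑*u b⊑*u a≺b

    ⊑*-vs-mismatch : ∀ {y y₂ g c a b ρ₁ ρ₂} → y ⊑* u → length y₂ ≤ length y → y₂ ⊑ g ⊎ g ⊑ y₂ →
                     u ≡ c ++ a ∷ ρ₁ → g ≡ c ++ b ∷ ρ₂ → a < b → y <ᵐ y₂ ⊎ y₂ ⊑ y
    ⊑*-vs-mismatch {y} {y₂} {g} {c} {a} {b} {ρ₁} {ρ₂} y⊑*u y₂≤y y₂~g u≡caρ₁ g≡cbρ₂ a<b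
      with ℕₚ.≤-<-connex (length y₂) (length c)
    ... | inj₁ y₂≤c =
      inj₂ (⊑*-by-length (⊑-⊑*-trans (⊑-trans (y₂⊑c y₂~g) (a ∷ ρ₁ , u≡caρ₁)) (u⊑*u u)) y⊑*u y₂≤y)
      where
      y₂⊑c : y₂ ⊑ g ⊎ g ⊑ y₂ → y₂ ⊑ c
      y₂⊑c (inj₁ y₂⊑g) = ⊑-by-length y₂⊑g (b ∷ ρ₂ , g≡cbρ₂) y₂≤c
      y₂⊑c (inj₂ g⊑y₂) = ⊥-elim (ℕₚ.<⇒≱ (factor-length-<ˡ c (b ∷ ρ₂) g≡cbρ₂ (λ ())) (ℕₚ.≤-trans (⊑⇒length≤ g⊑y₂) y₂≤c))
    ... | inj₂ c<y₂ = inj₁ (<ᵐ-⊑ (<ᵐ-++ˡ c (here {p = []} {[]} a<b)) ca⊑y (cb⊑y₂ y₂~g))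
      where
      cb⊑g : c ∷ʳ b ⊑ g
      cb⊑g = ρ₂ , trans g≡cbρ₂ (sym (++-assoc c [ b ] ρ₂))
      cb⊑y₂ : y₂ ⊑ g ⊎ g ⊑ y₂ → c ∷ʳ b ⊑ y₂
      cb⊑y₂ (inj₁ y₂⊑g) = ⊑-by-length cb⊑g y₂⊑g (subst (_≤ length y₂) (sym (length-∷ʳ c b)) c<y₂)
      cb⊑y₂ (inj₂ g⊑y₂) = ⊑-trans cb⊑g g⊑y₂
      ca⊑y : c ∷ʳ a ⊑ y
      ca⊑y = ⊑*-by-length (⊑-⊑*-trans (ρ₁ , trans u≡caρ₁ (sym (++-assoc c [ a ] ρ₁))) (u⊑*u u)) y⊑*u
               (ℕₚ.≤-trans (subst (_≤ length y₂) (sym (length-∷ʳ c a)) c<y₂) y₂≤y)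

    ⊑*-suffix-≥ᵐ : ∀ {y} s y₂ → y ⊑* u → y ≡ s ++ y₂ → s ≢ [] → y <ᵐ y₂ ⊎ y₂ ⊑ y
    ⊑*-suffix-≥ᵐ {y} s y₂ y⊑*u y≡sy₂ s≢[] with ⊑*-decompose (⊑-⊑*-trans (y₂ , y≡sy₂) y⊑*u)
    ... | m , t , g , s≡uᵐt , u≡tg , g≢[] = by-factor t u≡tg (⊑*-^ˡ⁻ m (subst (_⊑* u) y≡uᵐty₂ y⊑*u))
      where
      y≡uᵐty₂ : y ≡ u ^ m ++ t ++ y₂
      y≡uᵐty₂ = trans y≡sy₂ (trans (cong (_++ y₂) s≡uᵐt) (++-assoc (u ^ m) t y₂))
      y₂≤y : length y₂ ≤ length y
      y₂≤y = subst (λ x → length y₂ ≤ length x) (sym y≡sy₂) (length-++-≤ʳ y₂ {s})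
      by-factor : ∀ t → u ≡ t ++ g → t ++ y₂ ⊑* u → y <ᵐ y₂ ⊎ y₂ ⊑ y
      by-factor [] _ y₂⊑*u = inj₂ (⊑*-by-length y₂⊑*u y⊑*u y₂≤y)
      by-factor (x ∷ t) u≡tg ty₂⊑*u
        with c , a , b , ρ₁ , ρ₂ , a<b , u≡caρ₁ , g≡cbρ₂ ← <ᵐ-witness (Lyndon⇒<ᵐ-suffix lu (x ∷ t) g u≡tg (λ ()) g≢[])
        = ⊑*-vs-mismatch y⊑*u y₂≤y y₂~g u≡caρ₁ g≡cbρ₂ a<b
        where
        y₂~g : y₂ ⊑ g ⊎ g ⊑ y₂
        y₂~g with ⊑*-comparable ty₂⊑*u (subst (_⊑* u) u≡tg (u⊑*u u))
        ... | inj₁ ty₂⊑tg = inj₁ (⊑-++ˡ⁻ (x ∷ t) ty₂⊑tg)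
        ... | inj₂ tg⊑ty₂ = inj₂ (⊑-++ˡ⁻ (x ∷ t) tg⊑ty₂)

    ⊑*-∷ʳ-raise-Lyndon : ∀ {q d c} → q ∷ʳ d ⊑* u → d < c → Lyndon (q ∷ʳ c)
    ⊑*-∷ʳ-raise-Lyndon {q} {d} {c} qd⊑*u d<c =
      ∷ʳ-≢[] q c , λ s₁ s₂ s₁≢[] s₂≢[] eq → <ᵐ⇒<ʷ (below-suffix s₁ s₂ s₁≢[] s₂≢[] eq)
      where
      below-suffix : ∀ s₁ s₂ → s₁ ≢ [] → s₂ ≢ [] → q ∷ʳ c ≡ s₁ ++ s₂ → q ∷ʳ c <ᵐ s₂
      below-suffix s₁ s₂ s₁≢[] s₂≢[] eq with initLast s₂
      ... | [] = ⊥-elim (s₂≢[] refl)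
      ... | q₂ ∷ʳ′ x with q≡s₁q₂ , refl ← ∷ʳ-injective q (s₁ ++ q₂) (trans eq (sym (++-assoc s₁ q₂ [ x ])))
        with ⊑*-suffix-≥ᵐ s₁ (q₂ ∷ʳ d) qd⊑*u (trans (cong (_∷ʳ d) q≡s₁q₂) (++-assoc s₁ q₂ [ d ])) s₁≢[]
      ... | inj₁ qd<q₂d = <ᵐ-∷ʳ-raise q q₂ qd<q₂d (factor-length-<ʳ s₁ q₂ q≡s₁q₂ s₁≢[]) d<c
      ... | inj₂ q₂d⊑qd = <ᵐ-⊑ (<ᵐ-++ˡ q₂ (here {p = []} {[]} d<c)) (⊑-trans q₂d⊑q (p⊑p++q q [ c ])) (⊑-refl (q₂ ∷ʳ c))
        where
        q₂d⊑q : q₂ ∷ʳ d ⊑ q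
        q₂d⊑q = ⊑-by-length q₂d⊑qd (p⊑p++q q [ d ])
                  (subst (_≤ length q) (sym (length-∷ʳ q₂ d)) (factor-length-<ʳ s₁ q₂ q≡s₁q₂ s₁≢[]))

  -- The standard factorisation

  module StandardFactorization {w u v} (lw : Lyndon w) (std : LeftStdFact w u v) where

    private
      w≡uv = proj₁ std
      u≢[] = proj₁ (proj₂ std)
      v≢[] = proj₁ (proj₂ (proj₂ std))
      lu = proj₁ (proj₂ (proj₂ (proj₂ std)))
      u-longest = proj₂ (proj₂ (proj₂ (proj₂ std)))

    open PowerPrefixes u≢[]
    open LyndonPowerPrefixes u≢[] lu

    v-not-below-u^ω : ∀ p c d s → v ≡ p ++ c ∷ s → p ∷ʳ d ⊑* u → u ++ p ⊑* u → c < d → ⊥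
    v-not-below-u^ω p c d s v≡pcs pd⊑*u up⊑*u c<d
      with z , up≡pdz ← ⊑*-by-length pd⊑*u up⊑*u (length-∷ʳ-≤-++ u p d u≢[]) =
      Lyndon-suffix-≮ᵐ lw w≡uv u≢[] v≢[] (subst₂ _<ᵐ_ (sym v≡pcs) (sym w≡pdzcs) (<ᵐ-++ˡ p (here c<d)))
      where
      open ≡-Reasoning
      w≡pdzcs : w ≡ p ++ d ∷ (z ++ c ∷ s)
      w≡pdzcs = begin
        w                         ≡⟨ w≡uv ⟩
        u ++ v                    ≡⟨ cong (u ++_) v≡pcs ⟩
        u ++ p ++ c ∷ s           ≡⟨ sym (++-assoc u p (c ∷ s)) ⟩
        (u ++ p) ++ c ∷ s         ≡⟨ cong (_++ c ∷ s) up≡pdz ⟩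
        ((p ∷ʳ d) ++ z) ++ c ∷ s  ≡⟨ ++-assoc (p ∷ʳ d) z (c ∷ s) ⟩
        (p ∷ʳ d) ++ z ++ c ∷ s    ≡⟨ ++-assoc p [ d ] (z ++ c ∷ s) ⟩
        p ++ d ∷ (z ++ c ∷ s)     ∎

    -- The next letter of w can neither exceed that of u^ω (u is the longest Lyndon
    -- prefix) nor fall below it (v would be smaller than w).
    proper-prefix-⊑*-step : ∀ p c s → w ≡ p ++ c ∷ s → s ≢ [] → length u ≤ length p → p ⊑* u → p ∷ʳ c ⊑* u
    proper-prefix-⊑*-step p c s w≡pcs s≢[] u≤p p⊑*u with d , pd⊑*u ← ⊑*-extend p⊑*u with compare c d
    ... | tri≈ _ refl _ = pd⊑*u
    ... | tri> _ _ d<c = ⊥-elim (ℕₚ.<⇒≱ (s≤s u≤p) (subst (_≤ length u) (length-∷ʳ p c)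
                           (u-longest (p ∷ʳ c) s (trans w≡pcs (sym (++-assoc p [ c ] s))) (∷ʳ-≢[] p c) s≢[]
                             (⊑*-∷ʳ-raise-Lyndon pd⊑*u d<c))))
    ... | tri< c<d _ _ with p″ , refl ← ⊑-by-length (v , w≡uv) (c ∷ s , w≡pcs) u≤p =
      ⊥-elim (v-not-below-u^ω p″ c d s v≡p″cs (⊑*-++ˡ⁻ (subst (_⊑* u) (++-assoc u p″ [ d ]) pd⊑*u)) p⊑*u c<d)
      where
      v≡p″cs : v ≡ p″ ++ c ∷ s
      v≡p″cs = ++-cancelˡ u v (p″ ++ c ∷ s) (trans (sym w≡uv) (trans w≡pcs (++-assoc u p″ (c ∷ s))))

    proper-prefix-⊑* : ∀ p s → w ≡ p ++ s → s ≢ [] → p ⊑* u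
    proper-prefix-⊑* p s = go (suc (length p)) p s ℕₚ.≤-refl
      where
      go : ∀ n p s → length p ℕ.< n → w ≡ p ++ s → s ≢ [] → p ⊑* u
      go (suc n) p s (s≤s p≤n) w≡ps s≢[] with ℕₚ.≤-<-connex (length p) (length u)
      ... | inj₁ p≤u = ⊑-⊑*-trans (⊑-by-length (s , w≡ps) (v , w≡uv) p≤u) (u⊑*u u)
      ... | inj₂ u<p with initLast p
      ...   | [] = ⊥-elim (ℕₚ.n≮0 u<p)
      ...   | p′ ∷ʳ′ c = proper-prefix-⊑*-step p′ c s w≡p′cs s≢[] (ℕₚ.≤-pred (subst (length u ℕ.<_) (length-∷ʳ p′ c) u<p))
                          (go n p′ (c ∷ s) (subst (_≤ n) (length-∷ʳ p′ c) p≤n) w≡p′cs (λ ()))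
        where
        w≡p′cs : w ≡ p′ ++ c ∷ s
        w≡p′cs = trans w≡ps (++-assoc p′ [ c ] s)

    v-proper-prefix-⊑* : ∀ p s → v ≡ p ++ s → s ≢ [] → p ⊑* u
    v-proper-prefix-⊑* p s v≡ps s≢[] =
      ⊑*-++ˡ⁻ (proper-prefix-⊑* (u ++ p) s (trans w≡uv (trans (cong (u ++_) v≡ps) (sym (++-assoc u p s)))) s≢[])

    v-Lyndon : Lyndon v
    v-Lyndon with initLast v | v≢[] | w≡uv | v-proper-prefix-⊑*
    ... | []      | v≢[] | _     | _ = ⊥-elim (v≢[] refl)
    ... | q ∷ʳ′ c | v≢[] | w≡uqc | v-pre
      with q⊑*u ← v-pre q [ c ] refl (λ ())
      with d , qd⊑*u ← ⊑*-extend q⊑*u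
      with compare c d
    ... | tri> _ _ d<c = ⊑*-∷ʳ-raise-Lyndon qd⊑*u d<c
    ... | tri< c<d _ _ = ⊥-elim (v-not-below-u^ω q c d [] refl qd⊑*u (⊑*-++ˡ q⊑*u) c<d)
    ... | tri≈ _ refl _ = ⊥-elim (Lyndon-suffix-⋢ lw w≡uqc u≢[] v≢[] (subst (q ∷ʳ c ⊑_) (sym w≡uqc) qc⊑uqc))
      where
      qc⊑uqc : q ∷ʳ c ⊑ u ++ q ∷ʳ c
      qc⊑uqc = ⊑-trans (⊑*-by-length qd⊑*u (⊑*-++ˡ q⊑*u) (length-∷ʳ-≤-++ u q c u≢[])) (⊑-++ˡ u (p⊑p++q q [ c ]))

  SuffixesAbove : List A → List A → Set
  SuffixesAbove w s = ∀ p q → p ≢ [] → q ≢ [] → s ≡ p ++ q → w <ʷ q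

  SuffixesAbove-∷ : ∀ {w x s} → SuffixesAbove w s → (s ≢ [] → w <ʷ s) → SuffixesAbove w (x ∷ s)
  SuffixesAbove-∷ above w<s []          q p≢[] _    _  = ⊥-elim (p≢[] refl)
  SuffixesAbove-∷ above w<s (_ ∷ [])    q _    q≢[] eq with refl , refl ← ∷-injective eq = w<s q≢[]
  SuffixesAbove-∷ above w<s (_ ∷ y ∷ p) q _    q≢[] eq with refl , s≡ypq ← ∷-injective eq =
    above (y ∷ p) q (λ ()) q≢[] s≡ypq

  SuffixesAbove? : ∀ w s → Dec (SuffixesAbove w s)
  SuffixesAbove? w [] = yes λ { [] _ p≢[] _ _ → ⊥-elim (p≢[] refl) }
  SuffixesAbove? w (x ∷ s) with SuffixesAbove? w s | nonempty⇒<ʷ? s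
    where
    nonempty⇒<ʷ? : ∀ s → Dec (s ≢ [] → w <ʷ s)
    nonempty⇒<ʷ? []      = yes λ s≢[] → ⊥-elim (s≢[] refl)
    nonempty⇒<ʷ? (y ∷ s) with <-decidable _≟_ _<?_ w (y ∷ s)
    ... | yes w<s = yes λ _ → w<s
    ... | no  w≮s = no λ w<s → w≮s (w<s (λ ()))
  ... | no ¬above | _         = no λ above → ¬above λ p q p≢[] q≢[] eq → above (x ∷ p) q (λ ()) q≢[] (cong (x ∷_) eq)
  ... | yes _     | no ¬w<s   = no λ above → ¬w<s λ s≢[] → above [ x ] s (λ ()) s≢[] refl
  ... | yes above | yes w<s   = yes (SuffixesAbove-∷ above w<s)

  Lyndon? : ∀ w → Dec (Lyndon w)
  Lyndon? []      = no λ lw → proj₁ lw refl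
  Lyndon? (x ∷ s) with SuffixesAbove? (x ∷ s) (x ∷ s)
  ... | yes above = yes ((λ ()) , above)
  ... | no ¬above = no λ lw → ¬above (proj₂ lw)

  Lyndon-[_] : ∀ a → Lyndon [ a ]
  Lyndon-[ a ] = (λ ()) , λ where
    []          _       p≢[] _    _  → ⊥-elim (p≢[] refl)
    (_ ∷ [])    []      _    q≢[] _  → ⊥-elim (q≢[] refl)
    (_ ∷ [])    (_ ∷ _) _    _    ()
    (_ ∷ _ ∷ _) _       _    _    ()

  leftStdFact-exists : ∀ a b rest → ∃ λ u → ∃ λ v → LeftStdFact (a ∷ b ∷ rest) u v
  leftStdFact-exists a b rest
    with i , 1≤i , i≤ , lyn-i , none-above ← greatest-≤ (λ j → Lyndon? (take j (a ∷ b ∷ rest))) Lyndon-[ a ] (length rest)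
    = take i w , drop i w , sym (take++drop≡id i w) , take-≢[] 1≤i , drop-≢[] i w (s≤s i≤) , lyn-i , longest
    where
    w = a ∷ b ∷ rest
    take-≢[] : ∀ {i} → 1 ≤ i → take i w ≢ []
    take-≢[] {suc i} _ ()
    longest : ∀ u v → w ≡ u ++ v → u ≢ [] → v ≢ [] → Lyndon u → length u ≤ length (take i w)
    longest u v w≡uv _ v≢[] lu with ℕₚ.≤-<-connex (length u) i
    ... | inj₁ u≤i = subst (length u ≤_) (sym (length-take-≤ i w (ℕₚ.m≤n⇒m≤1+n i≤))) u≤i
    ... | inj₂ i<u = ⊥-elim (none-above (length u) i<u u≤ (subst Lyndon (sym take-u) lu))
      where
      u≤ : length u ≤ suc (length rest)
      u≤ = ℕₚ.≤-pred (subst (λ x → length u ℕ.< length x) (sym w≡uv) (length-++-<ˡ u v v≢[]))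
      take-u : take (length u) w ≡ u
      take-u = trans (cong (take (length u)) w≡uv) (take-length-++ u v)

  -- ω-powers and the order ≺

  infixr 4.5 _▹_
  _▹_ : List A → InfWord → InfWord
  ([]    ▹ X) i       = X i
  ((c ∷ p) ▹ X) zero    = c
  ((c ∷ p) ▹ X) (suc i) = (p ▹ X) i

  ▹-++ : ∀ p q X → (p ++ q) ▹ X ≗ p ▹ q ▹ X
  ▹-++ []      q X i       = refl
  ▹-++ (c ∷ p) q X zero    = refl
  ▹-++ (c ∷ p) q X (suc i) = ▹-++ p q X i

  ▹-cong : ∀ p {X Y} → X ≗ Y → p ▹ X ≗ p ▹ Y
  ▹-cong []      X≗Y i       = X≗Y i
  ▹-cong (c ∷ p) X≗Y zero    = refl
  ▹-cong (c ∷ p) X≗Y (suc i) = ▹-cong p X≗Y i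

  ▹-lookup-< : ∀ p X Y i → i ℕ.< length p → (p ▹ X) i ≡ (p ▹ Y) i
  ▹-lookup-< (c ∷ p) X Y zero    _   = refl
  ▹-lookup-< (c ∷ p) X Y (suc i) i<p = ▹-lookup-< p X Y i (ℕₚ.≤-pred i<p)

  ▹-lookup-+ : ∀ p X j → (p ▹ X) (length p + j) ≡ X j
  ▹-lookup-+ []      X j = refl
  ▹-lookup-+ (c ∷ p) X j = ▹-lookup-+ p X j

  ▹-nth : ∀ d p X i → i ℕ.< length p → (p ▹ X) i ≡ nth d p i
  ▹-nth d (c ∷ p) X zero    _   = refl
  ▹-nth d (c ∷ p) X (suc i) i<p = ▹-nth d p X i (ℕₚ.≤-pred i<p)

  ^ω-unfold : ∀ a xs → (a , xs) ^ω ≗ (a ∷ xs) ▹ (a , xs) ^ω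
  ^ω-unfold a xs i with ℕₚ.<-≤-connex i (suc (length xs))
  ... | inj₁ i<n = trans (cong (nth a (a ∷ xs)) (m<n⇒m%n≡m i<n)) (sym (▹-nth a (a ∷ xs) _ i i<n))
  ... | inj₂ n≤i = subst (λ k → ((a , xs) ^ω) k ≡ ((a ∷ xs) ▹ (a , xs) ^ω) k) (ℕₚ.m+[n∸m]≡n n≤i)
        (trans (cong (nth a (a ∷ xs)) (trans (cong (_% suc (length xs)) (ℕₚ.+-comm (suc (length xs)) j))
                                             ([m+n]%n≡m%n j (suc (length xs)))))
               (sym (▹-lookup-+ (a ∷ xs) _ j)))
    where j = i ∸ suc (length xs)

  ▹-fixpoint-unique : ∀ z {X Y} → z ≢ [] → X ≗ z ▹ X → Y ≗ z ▹ Y → X ≗ Y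
  ▹-fixpoint-unique z {X} {Y} z≢[] X-fix Y-fix i = go (suc i) i ℕₚ.≤-refl
    where
    go : ∀ n i → i ℕ.< n → X i ≡ Y i
    go (suc n) i i<n+1 with ℕₚ.<-≤-connex i (length z)
    ... | inj₁ i<z = trans (X-fix i) (trans (▹-lookup-< z X Y i i<z) (sym (Y-fix i)))
    ... | inj₂ z≤i = subst (λ k → X k ≡ Y k) (ℕₚ.m+[n∸m]≡n z≤i)
          (trans (X-fix (length z + j)) (trans (▹-lookup-+ z X j) (trans (go n j j<n)
            (sym (trans (Y-fix (length z + j)) (▹-lookup-+ z Y j))))))
      where
      j = i ∸ length z
      j<n : j ℕ.< n
      j<n = ℕₚ.≤-trans (subst (λ k → suc j ≤ k) (ℕₚ.m+[n∸m]≡n z≤i) (ℕₚ.+-monoˡ-≤ j (≢[]⇒1≤length z≢[]))) (ℕₚ.≤-pred i<n+1)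

  ▹-fixpoint-^ : ∀ z {X} → X ≗ z ▹ X → ∀ k → X ≗ (z ^ k) ▹ X
  ▹-fixpoint-^ z X-fix zero    i = refl
  ▹-fixpoint-^ z {X} X-fix (suc k) i =
    trans (X-fix i) (trans (▹-cong z (▹-fixpoint-^ z X-fix k) i) (sym (▹-++ z (z ^ k) X i)))

  <ᵐ⇒<∞-▹ : ∀ {p q} → p <ᵐ q → ∀ X Y → (p ▹ X) <∞ (q ▹ Y)
  <ᵐ⇒<∞-▹ (here a<b) X Y = 0 , (λ _ ()) , a<b
  <ᵐ⇒<∞-▹ (there p<q) X Y with n , agree , lt ← <ᵐ⇒<∞-▹ p<q X Y = suc n , agree′ , lt
    where
    agree′ : ∀ i → i ℕ.< suc n → _
    agree′ zero    _   = refl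
    agree′ (suc i) i<n = agree i (ℕₚ.≤-pred i<n)

  <∞-resp-≗ : ∀ {X X′ Y Y′} → X ≗ X′ → Y ≗ Y′ → X <∞ Y → X′ <∞ Y′
  <∞-resp-≗ X≗X′ Y≗Y′ (n , agree , lt) =
    n , (λ i i<n → trans (sym (X≗X′ i)) (trans (agree i i<n) (Y≗Y′ i))) , subst₂ _<_ (X≗X′ n) (Y≗Y′ n) lt

  <∞-irrefl : ∀ {X Y} → X ≗ Y → X <∞ Y → ⊥
  <∞-irrefl {X} X≗Y (n , _ , lt) = <-irrefl′ (subst (X n <_) (sym (X≗Y n)) lt)

  <∞-asym : ∀ {X Y} → X <∞ Y → Y <∞ X → ⊥
  <∞-asym {X} {Y} (n , agree , lt) (m , agree′ , lt′) with ℕₚ.<-cmp n m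
  ... | tri< n<m _ _ = <-irrefl′ (subst (X n <_) (agree′ n n<m) lt)
  ... | tri≈ _ refl _ = <-irrefl′ (<-trans lt lt′)
  ... | tri> _ _ m<n = <-irrefl′ (subst (Y m <_) (agree m m<n) lt′)

  <∞-trans : ∀ {X Y Z} → X <∞ Y → Y <∞ Z → X <∞ Z
  <∞-trans {X} {Y} {Z} (n , agree , lt) (m , agree′ , lt′) with ℕₚ.<-cmp n m
  ... | tri< n<m _ _ = n , (λ i i<n → trans (agree i i<n) (agree′ i (ℕₚ.<-trans i<n n<m))) , subst (X n <_) (agree′ n n<m) lt
  ... | tri≈ _ refl _ = n , (λ i i<n → trans (agree i i<n) (agree′ i i<n)) , <-trans lt lt′
  ... | tri> _ _ m<n = m , (λ i i<m → trans (agree i (ℕₚ.<-trans i<m m<n)) (agree′ i i<m)) , subst (_< Z m) (sym (agree m m<n)) lt′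

  infix 4 _≺ₗ_
  _≺ₗ_ : Rel (List A) 0ℓ
  []      ≺ₗ _       = ⊥
  (_ ∷ _) ≺ₗ []      = ⊥
  (a ∷ p) ≺ₗ (b ∷ q) = (a , p) ≺ (b , q)

  ≺ₗ-asym : ∀ {p q} → p ≺ₗ q → q ≺ₗ p → ⊥
  ≺ₗ-asym {_ ∷ _} {_ ∷ _} (inj₁ lt)       (inj₁ lt′)       = <∞-asym lt lt′
  ≺ₗ-asym {_ ∷ _} {_ ∷ _} (inj₁ lt)       (inj₂ (eq , _))  = <∞-irrefl (λ i → sym (eq i)) lt
  ≺ₗ-asym {_ ∷ _} {_ ∷ _} (inj₂ (eq , _)) (inj₁ lt)        = <∞-irrefl (λ i → sym (eq i)) lt
  ≺ₗ-asym {_ ∷ _} {_ ∷ _} (inj₂ (_ , lt)) (inj₂ (_ , lt′)) = ℕₚ.<-asym lt lt′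

  ≺ₗ-irrefl : ∀ {p} → p ≺ₗ p → ⊥
  ≺ₗ-irrefl p≺p = ≺ₗ-asym p≺p p≺p

  ≺ₗ-trans : ∀ {p q r} → p ≺ₗ q → q ≺ₗ r → p ≺ₗ r
  ≺ₗ-trans {_ ∷ _} {_ ∷ _} {_ ∷ _} (inj₁ lt)       (inj₁ lt′)        = inj₁ (<∞-trans lt lt′)
  ≺ₗ-trans {_ ∷ _} {_ ∷ _} {_ ∷ _} (inj₁ lt)       (inj₂ (eq , _))   = inj₁ (<∞-resp-≗ (λ _ → refl) eq lt)
  ≺ₗ-trans {_ ∷ _} {_ ∷ _} {_ ∷ _} (inj₂ (eq , _)) (inj₁ lt)         = inj₁ (<∞-resp-≗ (λ i → sym (eq i)) (λ _ → refl) lt)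
  ≺ₗ-trans {_ ∷ _} {_ ∷ _} {_ ∷ _} (inj₂ (eq , lt)) (inj₂ (eq′ , lt′)) = inj₂ ((λ i → trans (eq i) (eq′ i)) , ℕₚ.<-trans lt′ lt)

  comm-<ᵐ-^ˡ : ∀ x y → x ++ y <ᵐ y ++ x → ∀ n → x ^ suc n ++ y <ᵐ y ++ x ^ suc n
  comm-<ᵐ-^ˡ x y xy<yx zero = subst₂ _<ᵐ_ (cong (_++ y) (sym (++-identityʳ x))) (cong (y ++_) (sym (++-identityʳ x))) xy<yx
  comm-<ᵐ-^ˡ x y xy<yx (suc n) = subst₂ _<ᵐ_ (sym (++-assoc x (x ^ suc n) y)) (++-assoc y x (x ^ suc n))
    (<ᵐ-trans (subst (x ++ x ^ suc n ++ y <ᵐ_) (sym (++-assoc x y (x ^ suc n))) (<ᵐ-++ˡ x (comm-<ᵐ-^ˡ x y xy<yx n)))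
              (<ᵐ-++ʳ xy<yx (x ^ suc n) (x ^ suc n)))

  comm-<ᵐ-^ʳ : ∀ x y → x ++ y <ᵐ y ++ x → ∀ m → x ++ y ^ suc m <ᵐ y ^ suc m ++ x
  comm-<ᵐ-^ʳ x y xy<yx zero = subst₂ _<ᵐ_ (cong (x ++_) (sym (++-identityʳ y))) (cong (_++ x) (sym (++-identityʳ y))) xy<yx
  comm-<ᵐ-^ʳ x y xy<yx (suc m) = subst₂ _<ᵐ_ lhs rhs
    (<ᵐ-trans (<ᵐ-++ʳ (comm-<ᵐ-^ʳ x y xy<yx m) y y) (subst (_<ᵐ Y ++ y ++ x) (sym (++-assoc Y x y)) (<ᵐ-++ˡ Y xy<yx)))
    where
    Y = y ^ suc m
    lhs : (x ++ Y) ++ y ≡ x ++ y ^ suc (suc m)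
    lhs = trans (++-assoc x Y y) (cong (x ++_) (sym (^-comm y (suc m))))
    rhs : Y ++ y ++ x ≡ y ^ suc (suc m) ++ x
    rhs = trans (sym (++-assoc Y y x)) (cong (_++ x) (sym (^-comm y (suc m))))

  -- α^|β| and β^|α| are prefixes of the two ω-powers of the same length.
  comm-<ᵐ⇒^ω-< : ∀ a p b q → (a ∷ p) ++ (b ∷ q) <ᵐ (b ∷ q) ++ (a ∷ p) → ((a , p) ^ω) <∞ ((b , q) ^ω)
  comm-<ᵐ⇒^ω-< a p b q αβ<βα = by-trichotomy (<ᵐ-trichotomy αᴮ βᴬ |αᴮ|≡|βᴬ|)
    where
    α = a ∷ p
    β = b ∷ q
    αᴮ = α ^ length β
    βᴬ = β ^ length α
    |αᴮ|≡|βᴬ| : length αᴮ ≡ length βᴬ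
    |αᴮ|≡|βᴬ| = trans (length-^ α (length β)) (trans (ℕₚ.*-comm (length β) (length α)) (sym (length-^ β (length α))))
    αᴮβᴬ<βᴬαᴮ : αᴮ ++ βᴬ <ᵐ βᴬ ++ αᴮ
    αᴮβᴬ<βᴬαᴮ = comm-<ᵐ-^ʳ αᴮ β (comm-<ᵐ-^ˡ α β αβ<βα (length q)) (length p)
    by-trichotomy : αᴮ <ᵐ βᴬ ⊎ αᴮ ≡ βᴬ ⊎ βᴬ <ᵐ αᴮ → ((a , p) ^ω) <∞ ((b , q) ^ω)
    by-trichotomy (inj₁ αᴮ<βᴬ) = <∞-resp-≗ (λ i → sym (▹-fixpoint-^ α (^ω-unfold a p) (length β) i))
                                           (λ i → sym (▹-fixpoint-^ β (^ω-unfold b q) (length α) i))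
                                           (<ᵐ⇒<∞-▹ αᴮ<βᴬ _ _)
    by-trichotomy (inj₂ (inj₁ αᴮ≡βᴬ)) = ⊥-elim (<ᵐ-irrefl (subst (λ x → αᴮ ++ x <ᵐ x ++ αᴮ) (sym αᴮ≡βᴬ) αᴮβᴬ<βᴬαᴮ))
    by-trichotomy (inj₂ (inj₂ βᴬ<αᴮ)) = ⊥-elim (<ᵐ-asym αᴮβᴬ<βᴬαᴮ (<ᵐ-++ʳ βᴬ<αᴮ αᴮ βᴬ))

  comm⇒^ω-≗ : ∀ a p b q → (a ∷ p) ++ (b ∷ q) ≡ (b ∷ q) ++ (a ∷ p) → (a , p) ^ω ≗ (b , q) ^ω
  comm⇒^ω-≗ a p b q αβ≡βα = ▹-fixpoint-unique α (λ ()) (^ω-unfold a p) Y≗αY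
    where
    α = a ∷ p
    β = b ∷ q
    Y = (b , q) ^ω
    αY-fix : α ▹ Y ≗ β ▹ α ▹ Y
    αY-fix i = trans (▹-cong α (^ω-unfold b q) i)
                 (trans (sym (▹-++ α β Y i)) (trans (cong (λ x → (x ▹ Y) i) αβ≡βα) (▹-++ β α Y i)))
    Y≗αY : Y ≗ α ▹ Y
    Y≗αY = ▹-fixpoint-unique β (λ ()) (^ω-unfold b q) αY-fix

  ≺ᶠ⇒≺ₗ : ∀ {p q} → p ≺ᶠ q → p ≢ [] → q ≢ [] → p ≺ₗ q
  ≺ᶠ⇒≺ₗ {[]}    _ p≢[] _ = ⊥-elim (p≢[] refl)
  ≺ᶠ⇒≺ₗ {_ ∷ _} {[]} _ _ q≢[] = ⊥-elim (q≢[] refl)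
  ≺ᶠ⇒≺ₗ {a ∷ p} {b ∷ q} (inj₁ lt)        _ _ = inj₁ (comm-<ᵐ⇒^ω-< a p b q lt)
  ≺ᶠ⇒≺ₗ {a ∷ p} {b ∷ q} (inj₂ (eq , lt)) _ _ = inj₂ (comm⇒^ω-≗ a p b q eq , ℕₚ.≤-pred lt)

  ≺ᶠ-trichotomy : ∀ p q → p ≺ᶠ q ⊎ p ≡ q ⊎ q ≺ᶠ p
  ≺ᶠ-trichotomy p q with <ᵐ-trichotomy (p ++ q) (q ++ p) (length-++-comm p q)
  ... | inj₁ pq<qp = inj₁ (inj₁ pq<qp)
  ... | inj₂ (inj₂ qp<pq) = inj₂ (inj₂ (inj₁ qp<pq))
  ... | inj₂ (inj₁ pq≡qp) with ℕₚ.<-cmp (length p) (length q)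
  ...   | tri< p<q _ _ = inj₂ (inj₂ (inj₂ (sym pq≡qp , p<q)))
  ...   | tri≈ _ p≡q _ = inj₂ (inj₁ (proj₁ (++-injective p q q p pq≡qp p≡q)))
  ...   | tri> _ _ q<p = inj₁ (inj₂ (pq≡qp , q<p))

  ≺ₗ⇒≺ᶠ : ∀ {p q} → p ≢ [] → q ≢ [] → p ≺ₗ q → p ≺ᶠ q
  ≺ₗ⇒≺ᶠ {p} {q} p≢[] q≢[] p≺q with ≺ᶠ-trichotomy p q
  ... | inj₁ p≺ᶠq = p≺ᶠq
  ... | inj₂ (inj₁ refl) = ⊥-elim (≺ₗ-irrefl p≺q)
  ... | inj₂ (inj₂ q≺ᶠp) = ⊥-elim (≺ₗ-asym p≺q (≺ᶠ⇒≺ₗ q≺ᶠp q≢[] p≢[]))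

  ≺ₗ-compare : ∀ p q → p ≢ [] → q ≢ [] → Tri (p ≺ₗ q) (p ≡ q) (q ≺ₗ p)
  ≺ₗ-compare p q p≢[] q≢[] with ≺ᶠ-trichotomy p q
  ... | inj₁ p≺q        = let lt = ≺ᶠ⇒≺ₗ p≺q p≢[] q≢[] in
                          tri< lt (λ { refl → ≺ₗ-irrefl lt }) (≺ₗ-asym lt)
  ... | inj₂ (inj₁ p≡q) = tri≈ (λ lt → ≺ₗ-irrefl (subst (p ≺ₗ_) (sym p≡q) lt)) p≡q
                               (λ gt → ≺ₗ-irrefl (subst (q ≺ₗ_) p≡q gt))
  ... | inj₂ (inj₂ q≺p) = let gt = ≺ᶠ⇒≺ₗ q≺p q≢[] p≢[] in
                          tri> (λ lt → ≺ₗ-asym lt gt) (λ { refl → ≺ₗ-irrefl gt }) gt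

module LyndonTrees {A : Set} {_<_ : Rel A 0ℓ} (<-isSTO : IsStrictTotalOrder _≡_ _<_) where

  open Words _<_
  open OrderedAlphabet <-isSTO

  properPrefixes : List A → List (List A)
  properPrefixes []           = []
  properPrefixes (a ∷ [])     = []
  properPrefixes (a ∷ b ∷ xs) = [ a ] ∷ map (a ∷_) (properPrefixes (b ∷ xs))

  properPrefixes-++ : ∀ u v → u ≢ [] → v ≢ [] →
                      properPrefixes (u ++ v) ≡ properPrefixes u ++ u ∷ map (u ++_) (properPrefixes v)
  properPrefixes-++ []          v u≢[] _    = ⊥-elim (u≢[] refl)
  properPrefixes-++ (a ∷ [])    []      _ v≢[] = ⊥-elim (v≢[] refl)
  properPrefixes-++ (a ∷ [])    (b ∷ v) _ _    = refl
  properPrefixes-++ (a ∷ b ∷ u) v       _ v≢[] = cong ([ a ] ∷_) (begin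
      map (a ∷_) (properPrefixes ((b ∷ u) ++ v))
        ≡⟨ cong (map (a ∷_)) (properPrefixes-++ (b ∷ u) v (λ ()) v≢[]) ⟩
      map (a ∷_) (properPrefixes (b ∷ u) ++ (b ∷ u) ∷ map ((b ∷ u) ++_) (properPrefixes v))
        ≡⟨ map-++ (a ∷_) (properPrefixes (b ∷ u)) _ ⟩
      map (a ∷_) (properPrefixes (b ∷ u)) ++ (a ∷ b ∷ u) ∷ map (a ∷_) (map ((b ∷ u) ++_) (properPrefixes v))
        ≡⟨ cong (λ x → map (a ∷_) (properPrefixes (b ∷ u)) ++ (a ∷ b ∷ u) ∷ x) (sym (map-∘ (properPrefixes v))) ⟩
      map (a ∷_) (properPrefixes (b ∷ u)) ++ (a ∷ b ∷ u) ∷ map ((a ∷ b ∷ u) ++_) (properPrefixes v) ∎)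
    where open ≡-Reasoning

  ProperPrefix : List A → List A → Set
  ProperPrefix w p = p ≢ [] × ∃ λ s → s ≢ [] × w ≡ p ++ s

  properPrefixes-proper : ∀ w → All (ProperPrefix w) (properPrefixes w)
  properPrefixes-proper []           = []
  properPrefixes-proper (a ∷ [])     = []
  properPrefixes-proper (a ∷ b ∷ xs) = ((λ ()) , b ∷ xs , (λ ()) , refl) ∷
    Allₚ.map⁺ (All.map (λ { (_ , s , s≢[] , eq) → (λ ()) , s , s≢[] , cong (a ∷_) eq }) (properPrefixes-proper (b ∷ xs)))

  -- The index k stands for the prefix of length k + 1, as in prefix of Defs.
  nonemptyPrefix : A → List A → ∀ {m} → Fin m → List A
  nonemptyPrefix a ys k = a ∷ take (toℕ k) ys

  nonemptyPrefix-injective : ∀ a ys {k l : Fin (suc (length ys))} → nonemptyPrefix a ys k ≡ nonemptyPrefix a ys l → k ≡ l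
  nonemptyPrefix-injective a ys {k} {l} eq = Finₚ.toℕ-injective
    (trans (sym (length-take-≤ (toℕ k) ys (ℕₚ.≤-pred (Finₚ.toℕ<n k))))
           (trans (cong (λ p → length (drop 1 p)) eq) (length-take-≤ (toℕ l) ys (ℕₚ.≤-pred (Finₚ.toℕ<n l)))))

  nonemptyPrefix-≺ₗ-isSTO : ∀ a ys →
    IsStrictTotalOrder _≡_ (λ (k l : Fin (suc (length ys))) → nonemptyPrefix a ys k ≺ₗ nonemptyPrefix a ys l)
  nonemptyPrefix-≺ₗ-isSTO a ys = isStrictTotalOrderᶜ record
    { isEquivalence = isEquivalence
    ; trans         = ≺ₗ-trans
    ; compare       = compare-prefixes
    }
    where
    compare-prefixes : ∀ k l → Tri (nonemptyPrefix a ys k ≺ₗ nonemptyPrefix a ys l) (k ≡ l)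
                                   (nonemptyPrefix a ys l ≺ₗ nonemptyPrefix a ys k)
    compare-prefixes k l with ≺ₗ-compare (nonemptyPrefix a ys k) (nonemptyPrefix a ys l) (λ ()) (λ ())
    ... | tri< lt  k≢l ¬gt = tri< lt (λ k≡l → k≢l (cong (nonemptyPrefix a ys) k≡l)) ¬gt
    ... | tri≈ ¬lt k≡l ¬gt = tri≈ ¬lt (nonemptyPrefix-injective a ys k≡l) ¬gt
    ... | tri> ¬lt k≢l gt  = tri> ¬lt (λ k≡l → k≢l (cong (nonemptyPrefix a ys) k≡l)) gt

  properPrefixes-tabulate : ∀ a ys → properPrefixes (a ∷ ys) ≡ tabulate (nonemptyPrefix a ys {length ys})
  properPrefixes-tabulate a []       = refl
  properPrefixes-tabulate a (y ∷ ys) = cong ([ a ] ∷_) (trans (cong (map (a ∷_)) (properPrefixes-tabulate y ys))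
                                         (map-tabulate (nonemptyPrefix y ys {length ys}) (a ∷_)))

  map-nonemptyPrefix : ∀ a ys → map (nonemptyPrefix a ys) (allFin (length ys)) ≡ properPrefixes (a ∷ ys)
  map-nonemptyPrefix a ys = trans (map-tabulate id (nonemptyPrefix a ys)) (sym (properPrefixes-tabulate a ys))

  alphaLabel : ∀ {n} → Permutation′ (suc n) → Fin n → ℕ
  alphaLabel σ i = suc (toℕ (σ ⟨$⟩ʳ inject₁ i))

  lst⇒IsCartesian : ∀ {w t} → Lyndon w → IsLst w t → IsCartesian _≺ₗ_ (properPrefixes w) w t
  lst⇒IsCartesian lw (lst-letter a) = cleaf a
  lst⇒IsCartesian {w} lw (lst-node {u = u} {v} {t₁} {t₂} std lst-u lst-v) =
    subst₂ (λ ks x → IsCartesian _≺ₗ_ ks x (node t₁ t₂))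
           (sym (trans (cong properPrefixes w≡uv) (properPrefixes-++ u v u≢[] v≢[]))) (sym w≡uv)
           (cnode below-u-left below-u-right (lst⇒IsCartesian lu lst-u) right-subtree)
    where
    w≡uv = proj₁ std
    u≢[] = proj₁ (proj₂ std)
    v≢[] = proj₁ (proj₂ (proj₂ std))
    lu = proj₁ (proj₂ (proj₂ (proj₂ std)))
    open PowerPrefixes u≢[]
    open LyndonPowerPrefixes u≢[] lu
    open StandardFactorization lw std using (v-Lyndon; v-proper-prefix-⊑*)
    below-u : ∀ {p} → p ≢ [] → p ⊑* u → length p ≢ length u → p ≺ₗ u
    below-u {p} p≢[] p⊑*u |p|≢|u| = ≺ᶠ⇒≺ₗ (⊑*⇒≺ᶠ p≢[] p⊑*u (λ p≡u → |p|≢|u| (cong length p≡u))) p≢[] u≢[]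
    below-u-left : All (_≺ₗ u) (properPrefixes u)
    below-u-left = All.map (λ { {p} (p≢[] , s , s≢[] , u≡ps) →
      below-u p≢[] (⊑-⊑*-trans (s , u≡ps) (u⊑*u u))
        (λ |p|≡|u| → ℕₚ.<-irrefl |p|≡|u| (factor-length-<ˡ p s u≡ps s≢[])) })
      (properPrefixes-proper u)
    below-u-right : All (_≺ₗ u) (map (u ++_) (properPrefixes v))
    below-u-right = Allₚ.map⁺ (All.map (λ { {p} (p≢[] , s , s≢[] , v≡ps) →
      below-u (++-≢[]ˡ u p u≢[]) (⊑*-++ˡ (v-proper-prefix-⊑* p s v≡ps s≢[]))
        (λ |up|≡|u| → ℕₚ.<-irrefl (sym |up|≡|u|) (length-++-<ˡ u p p≢[])) })
      (properPrefixes-proper v))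
    right-subtree : IsCartesian _≺ₗ_ (map (u ++_) (properPrefixes v)) v t₂
    right-subtree = IsCartesian-relabel {P = λ p → p ≢ [] × p ⊑* u} id (u ++_)
      (λ { {p} {q} (p≢[] , p⊑*u) (q≢[] , q⊑*u) p≺q →
           ≺ᶠ⇒≺ₗ (≺ᶠ-++ˡ p⊑*u q⊑*u (≺ₗ⇒≺ᶠ p≢[] q≢[] p≺q)) (++-≢[]ˡ u p u≢[]) (++-≢[]ˡ u q u≢[]) })
      (All.map (λ { {p} (p≢[] , s , s≢[] , v≡ps) → p≢[] , v-proper-prefix-⊑* p s v≡ps s≢[] }) (properPrefixes-proper v))
      (subst (λ ks → IsCartesian _≺ₗ_ ks v t₂) (sym (map-id (properPrefixes v))) (lst⇒IsCartesian v-Lyndon lst-v))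

  tl⇒IsCartesian : ∀ {w t} → IsTl w t → IsCartesian _≺ₗ_ (properPrefixes w) w t
  tl⇒IsCartesian (tl-letter a) = cleaf a
  tl⇒IsCartesian (tl-word a x xs σ t* t σ-std dec-t* fill-t*)
    with w₁ , w≡w₁ , cart ← fill⇒IsCartesian dec-t* (a ∷ x ∷ xs) fill-t* =
    subst₂ (λ ks w → IsCartesian _≺ₗ_ ks w t) (map-nonemptyPrefix a ys) (sym (trans w≡w₁ (++-identityʳ w₁)))
      (IsCartesian-relabel {P = λ _ → ⊤} (alphaLabel σ) (nonemptyPrefix a ys) mono (All.universal (λ _ → tt) (allFin n)) cart)
    where
    ys = x ∷ xs
    n = length ys
    mono : ∀ {i j} → ⊤ → ⊤ → alphaLabel σ i ℕ.< alphaLabel σ j → nonemptyPrefix a ys i ≺ₗ nonemptyPrefix a ys j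
    mono {i} {j} _ _ (s≤s σi<σj) =
      subst₂ (λ k l → (a , take k ys) ≺ (a , take l ys)) (Finₚ.toℕ-inject₁ i) (Finₚ.toℕ-inject₁ j)
        (subst₂ (λ k l → prefix a ys k ≺ prefix a ys l) (inverseˡ σ) (inverseˡ σ) (σ-std _ _ σi<σj))

  lst-exists : ∀ w → Lyndon w → ∃ λ t → IsLst w t
  lst-exists w = go (suc (length w)) w ℕₚ.≤-refl
    where
    go : ∀ n w → length w ℕ.< n → Lyndon w → ∃ λ t → IsLst w t
    go n       []             _         lw = ⊥-elim (proj₁ lw refl)
    go n       (a ∷ [])       _         _  = leaf a , lst-letter a
    go (suc n) (a ∷ b ∷ rest) (s≤s w<n) lw
      with u , v , std@(w≡uv , u≢[] , v≢[] , lu , _) ← leftStdFact-exists a b rest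
      with t₁ , lst-u ← go n u (ℕₚ.<-≤-trans (factor-length-<ˡ u v w≡uv v≢[]) w<n) lu
      with t₂ , lst-v ← go n v (ℕₚ.<-≤-trans (factor-length-<ʳ u v w≡uv u≢[]) w<n) (StandardFactorization.v-Lyndon lw std)
      = node t₁ t₂ , lst-node std lst-u lst-v

  IsCartesian⇒tl : ∀ {w t} → w ≢ [] → IsCartesian _≺ₗ_ (properPrefixes w) w t → IsTl w t
  IsCartesian⇒tl {[]}         w≢[] _    = ⊥-elim (w≢[] refl)
  IsCartesian⇒tl {a ∷ []}     _    cart = subst (IsTl [ a ]) (IsCartesian-unique ≺ₗ-asym (cleaf a) cart) (tl-letter a)
  IsCartesian⇒tl {a ∷ x ∷ xs} {t} _ cart =
    tl-word a x xs σ t* t (λ _ _ → rankPermutation⁻¹-mono) dec-t*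
      (subst (λ w → fill t* w ≡ just (t , [])) (++-identityʳ (a ∷ x ∷ xs)) (fill-t* []))
    where
    ys = x ∷ xs
    n = length ys
    open RankPermutation (nonemptyPrefix-≺ₗ-isSTO a ys)
    σ = rankPermutation
    mono : ∀ {i j} → ⊤ → ⊤ → nonemptyPrefix a ys i ≺ₗ nonemptyPrefix a ys j → alphaLabel σ i ℕ.< alphaLabel σ j
    mono {i} {j} _ _ lt = s≤s (rank-mono (subst₂ (λ k l → (a , take k ys) ≺ (a , take l ys))
                                (sym (Finₚ.toℕ-inject₁ i)) (sym (Finₚ.toℕ-inject₁ j)) lt))
    relabelled : IsCartesian ℕ._<_ (alpha σ) (a ∷ ys) t
    relabelled = IsCartesian-relabel {P = λ _ → ⊤} (nonemptyPrefix a ys) (alphaLabel σ) mono (All.universal (λ _ → tt) (allFin n))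
      (subst (λ ks → IsCartesian _≺ₗ_ ks (a ∷ ys) t) (sym (map-nonemptyPrefix a ys)) cart)
    t* = proj₁ (IsCartesian⇒fill relabelled)
    dec-t* = proj₁ (proj₂ (IsCartesian⇒fill relabelled))
    fill-t* = proj₂ (proj₂ (IsCartesian⇒fill relabelled))

theorem7 : (A : Set) (_<_ : Rel A 0ℓ) → IsStrictTotalOrder _≡_ _<_ →
           (w : List A) → Words.Lyndon _<_ w →
           (∃ λ t → Words.IsLst _<_ w t × Words.IsTl _<_ w t) ×
           (∀ t t′ → Words.IsLst _<_ w t → Words.IsTl _<_ w t′ → t ≡ t′)
theorem7 A _<_ <-isSTO w lw = existence , uniqueness
  where
  open Words _<_
  open OrderedAlphabet <-isSTO using (≺ₗ-asym)
  open LyndonTrees <-isSTO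
  existence : ∃ λ t → IsLst w t × IsTl w t
  existence with t , lst ← lst-exists w lw = t , lst , IsCartesian⇒tl (proj₁ lw) (lst⇒IsCartesian lw lst)
  uniqueness : ∀ t t′ → IsLst w t → IsTl w t′ → t ≡ t′
  uniqueness t t′ lst tl = IsCartesian-unique ≺ₗ-asym (lst⇒IsCartesian lw lst) (tl⇒IsCartesian tl)
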